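{- If $G$ is a triconnected plane graph, then its latching graph $L_G$ is simple (has no parallel edges).
   Context: A plane graph is a graph drawn on the sphere with vertices as points and edges as simple curves not crossing except at common ends; for a biconnected plane graph each face is bounded by a cycle. $G$ is triconnected if every separator has at least three vertices. The latching graph $L_G$ of a biconnected plane graph $G$ is the multigraph obtained from $G$ by, for each face $f$ whose bounding cycle has four or more vertices, drawing every chord of that cycle inside $f$ (so an edge may be added once for each face in which it is a chord). -}

module Defs where

open import Data.Nat using (ℕ; zero; suc; _+_; _*_; _≤_; _<ᵇ_; _≤ᵇ_)
open import Data.Fin using (Fin; toℕ; _≟_)
open import Data.Bool using (Bool; true; false; _∧_; _∨_; not; if_then_else_)
open import Data.List using (List; allFin; map; upTo; concatMap)
open import Data.Nat.ListAction using (sum)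
open import Data.Bool.ListAction using (any)
open import Data.Product using (_×_; _,_; ∃; Σ-syntax)
open import Data.Sum using (_⊎_)
open import Data.Fin.Subset using (Subset; _∉_; ∣_∣; ⊥)
open import Relation.Nullary using (¬_)
open import Relation.Nullary.Decidable using (⌊_⌋)
open import Relation.Binary.PropositionalEquality using (_≡_)

iter : {A : Set} → (A → A) → ℕ → A → A
iter f zero    a = a
iter f (suc k) a = f (iter f k a)

countL : {A : Set} → (A → Bool) → List A → ℕ
countL p xs = sum (map (λ x → if p x then 1 else 0) xs)

-- A simple graph on vertex set Fin n is given by a boolean adjacency
-- relation (irreflexive, symmetric).  An embedding in the sphere is
-- described combinatorially by a rotation system: for every vertex v,
-- rot v is a cyclic permutation of the neighbours of v (the clockwise
-- order of the edges around v).  Darts are ordered pairs (u , v) with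
-- u adjacent to v; faces are the orbits of the face-tracing permutation
-- (u , v) ↦ (v , rot v u).

module Faces {n : ℕ} (adj : Fin n → Fin n → Bool)
             (rot : Fin n → Fin n → Fin n) where

  Dart : Set
  Dart = Fin n × Fin n

  isDart : Dart → Bool
  isDart (u , v) = adj u v

  darts : List Dart
  darts = concatMap (λ u → map (λ v → (u , v)) (allFin n)) (allFin n)

  countD : (Dart → Bool) → ℕ
  countD p = countL p darts

  countV : (Fin n → Bool) → ℕ
  countV p = countL p (allFin n)

  eqD : Dart → Dart → Bool
  eqD (u , v) (u' , v') = ⌊ u ≟ u' ⌋ ∧ ⌊ v ≟ v' ⌋

  faceNext : Dart → Dart
  faceNext (u , v) = (v , rot v u)

  -- e lies on the same face (orbit of faceNext) as d; orbits have
  -- length at most the number of darts, which is ≤ n * n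
  sameFace : Dart → Dart → Bool
  sameFace d e = any (λ k → eqD (iter faceNext k d) e) (upTo (n * n))

  code : Dart → ℕ
  code (u , v) = toℕ u * n + toℕ v

  isFaceRep : Dart → Bool
  isFaceRep d = isDart d ∧ not (any (λ e → sameFace d e ∧ (code e <ᵇ code d)) darts)

  numFaces : ℕ
  numFaces = countD isFaceRep

  numDarts : ℕ      -- = 2 * (number of edges)
  numDarts = countD isDart

  onFace : Dart → Fin n → Bool
  onFace d x = any (λ y → isDart (x , y) ∧ sameFace d (x , y)) (allFin n)

  faceSize : Dart → ℕ
  faceSize d = countV (onFace d)

  boundaryEdge : Dart → Fin n → Fin n → Bool
  boundaryEdge d x y = sameFace d (x , y) ∨ sameFace d (y , x)

  isChord : Dart → Fin n → Fin n → Bool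
  isChord d x y = not ⌊ x ≟ y ⌋ ∧ onFace d x ∧ onFace d y ∧ not (boundaryEdge d x y)

  -- multiplicity of the edge {x , y} in the latching graph L_G:
  -- one copy if it is an edge of G, plus one copy for every face with
  -- at least four boundary vertices in whose boundary cycle it is a chord
  latchMult : Fin n → Fin n → ℕ
  latchMult x y =
    (if adj x y then 1 else 0)
    + countD (λ d → isFaceRep d ∧ (4 ≤ᵇ faceSize d) ∧ isChord d x y)

data WalkAvoiding {n : ℕ} (adj : Fin n → Fin n → Bool) (S : Subset n)
       : Fin n → Fin n → Set where
  stop : ∀ {x} → x ∉ S → WalkAvoiding adj S x x
  step : ∀ {x y z} → x ∉ S → adj x y ≡ true → WalkAvoiding adj S y z
       → WalkAvoiding adj S x z

Connected : {n : ℕ} → (Fin n → Fin n → Bool) → Set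
Connected adj = ∀ x y → WalkAvoiding adj ⊥ x y

IsSeparator : {n : ℕ} → (Fin n → Fin n → Bool) → Subset n → Set
IsSeparator adj S =
  ∃ λ x → ∃ λ y → x ∉ S × y ∉ S × ¬ WalkAvoiding adj S x y

Triconnected : {n : ℕ} → (Fin n → Fin n → Bool) → Set
Triconnected adj = Connected adj × (∀ S → IsSeparator adj S → 3 ≤ ∣ S ∣)

record PlaneGraph (n : ℕ) : Set where
  field
    adj        : Fin n → Fin n → Bool
    adj-irrefl : ∀ x → adj x x ≡ false
    adj-sym    : ∀ x y → adj x y ≡ adj y x
    rot        : Fin n → Fin n → Fin n
    rot-closed : ∀ v u → adj v u ≡ true → adj v (rot v u) ≡ true
    rot-cyclic : ∀ v u w → adj v u ≡ true → adj v w ≡ true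
               → ∃ λ k → iter (rot v) k u ≡ w
    connected  : Connected adj
    -- Euler's formula V - E + F = 2 (genus 0); an edgeless connected graph
    -- (a single vertex) is trivially plane
    spherical  : Faces.numDarts adj rot ≡ 0
               ⊎ 2 * (n + Faces.numFaces adj rot) ≡ 4 + Faces.numDarts adj rot

latchMult : {n : ℕ} → PlaneGraph n → Fin n → Fin n → ℕ
latchMult G = Faces.latchMult (PlaneGraph.adj G) (PlaneGraph.rot G)

LatchingSimple : {n : ℕ} → PlaneGraph n → Set
LatchingSimple {n} G = ∀ (x y : Fin n) → latchMult G x y ≤ 1

{-# OPTIONS --safe #-}
module Submission where

-- A plane graph is a combinatorial map: darts (u , v), the rotation σ around vertices, the
-- reversal α, and faces the cycles of σ ∘ α. For every connected map, with V vertices (cycles of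
-- σ), F faces and D darts, Euler's inequality 2 V + 2 F ≤ D + 4 holds: insert the edges one at a
-- time into the map without edges, which has V faces; an edge inside one face splits it, an edge
-- between two faces merges them, and connectivity forces at least V - 1 merges.
--
-- If {x, y} is a chord of a face and also an edge or a chord of a second face, then x and y lie
-- on two common faces. Cut the rotation at x and at y between these two faces: V grows by 2,
-- while the two faces are merged at x and split again at y, so F is unchanged. Since G is
-- triconnected, G - {x, y} is connected, hence so is the new map, and Euler's inequality for it
-- contradicts Euler's formula 2 V + 2 F = D + 4 for G.

open import Defs
open import Data.Bool using (Bool; true; false; _∧_; _∨_; not; if_then_else_)
open import Data.Bool.ListAction using (any)
open import Data.Bool.Properties using (T-≡; ∧-conicalˡ; ∧-conicalʳ; ∨-conicalˡ; ∨-conicalʳ; ∨-comm; ∨-zeroʳ)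
open import Data.Empty using (⊥; ⊥-elim)
open import Data.Fin using (Fin; zero; suc; toℕ; fromℕ<; combine; _≟_)
import Data.Fin.Properties as Finₚ
open import Data.Fin.Subset using (Subset; ⁅_⁆; _∪_; ∣_∣; _∉_) renaming (⊥ to ∅)
open import Data.Fin.Subset.Properties using (x∈p∪q⁻; x∈p∪q⁺; x∈⁅y⁆⇒x≡y; x∈⁅x⁆; ∣⁅x⁆∣≡1)
open import Data.List using (List; []; _∷_; _++_; map; concatMap; upTo; applyUpTo; allFin; length)
import Data.List.Properties as Listₚ
open import Data.Nat hiding (_≟_)
open import Data.Nat.DivMod using (_%_; _/_; m%n<n; m≡m%n+[m/n]*n)
open import Data.Nat.ListAction using (sum)
open import Data.Nat.Properties hiding (_≟_)
open import Algebra.Properties.CommutativeSemigroup +-commutativeSemigroup using (interchange)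
open import Data.Nat.Solver using (module +-*-Solver)
open import Data.Product using (Σ; ∃; _×_; _,_; proj₁; proj₂)
open import Data.Product.Properties using (≡-dec)
open import Data.Sum using (_⊎_; inj₁; inj₂; [_,_]′)
open import Data.Vec using ([]; _∷_)
open import Function.Base using (_∘_)
open import Function.Bundles using (Equivalence)
open import Relation.Binary.Definitions using (tri<; tri≈; tri>)
open import Relation.Binary.PropositionalEquality
open import Relation.Nullary using (¬_; Dec; yes; no)
open import Relation.Nullary.Decidable using (⌊_⌋; decidable-stable)
open +-*-Solver using (solve; _:+_; _:*_; _:=_; con)

module _ {A : Set} (f : A → A) where

  iter-+ : ∀ m k x → iter f (m + k) x ≡ iter f m (iter f k x)
  iter-+ zero    k x = refl
  iter-+ (suc m) k x = cong f (iter-+ m k x)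

  iter-*-fixed : ∀ m x → iter f m x ≡ x → ∀ q → iter f (q * m) x ≡ x
  iter-*-fixed m x fixed zero    = refl
  iter-*-fixed m x fixed (suc q) = begin
    iter f (m + q * m) x         ≡⟨ iter-+ m (q * m) x ⟩
    iter f m (iter f (q * m) x)  ≡⟨ cong (iter f m) (iter-*-fixed m x fixed q) ⟩
    iter f m x                   ≡⟨ fixed ⟩
    x                            ∎
    where open ≡-Reasoning

  iter-%-fixed : ∀ m x → iter f m x ≡ x → .{{_ : NonZero m}} → ∀ k → iter f k x ≡ iter f (k % m) x
  iter-%-fixed m x fixed k = begin
    iter f k x                                ≡⟨ cong (λ j → iter f j x) (m≡m%n+[m/n]*n k m) ⟩
    iter f (k % m + (k / m) * m) x            ≡⟨ iter-+ (k % m) ((k / m) * m) x ⟩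
    iter f (k % m) (iter f ((k / m) * m) x)   ≡⟨ cong (iter f (k % m)) (iter-*-fixed m x fixed (k / m)) ⟩
    iter f (k % m) x                          ∎
    where open ≡-Reasoning

  iter-fixed : ∀ x → f x ≡ x → ∀ k → iter f k x ≡ x
  iter-fixed x fx zero    = refl
  iter-fixed x fx (suc k) = trans (cong f (iter-fixed x fx k)) fx

  iter-preserves : (P : A → Set) → (∀ x → P x → P (f x)) → ∀ k x → P x → P (iter f k x)
  iter-preserves P pres zero    x px = px
  iter-preserves P pres (suc k) x px = pres _ (iter-preserves P pres k x px)

iter-agree : ∀ {A : Set} (f g : A → A) (P : A → Set) → (∀ x → P x → P (f x)) → (∀ x → P x → f x ≡ g x)
           → ∀ k x → P x → iter f k x ≡ iter g k x
iter-agree f g P pres agree zero    x px = refl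
iter-agree f g P pres agree (suc k) x px =
  trans (agree _ (iter-preserves f P pres k x px)) (cong g (iter-agree f g P pres agree k x px))

Orbit : ∀ {A : Set} → (A → A) → A → A → Set
Orbit π x y = ∃ λ k → iter π k x ≡ y

module _ {A : Set} (π : A → A) where

  Orbit-refl : ∀ x → Orbit π x x
  Orbit-refl x = 0 , refl

  Orbit-step : ∀ x → Orbit π x (π x)
  Orbit-step x = 1 , refl

  Orbit-trans : ∀ {x y z} → Orbit π x y → Orbit π y z → Orbit π x z
  Orbit-trans {x} (k , refl) (l , refl) = l + k , iter-+ π l k x

Orbit-agree : ∀ {A : Set} (π π′ : A → A) (P : A → Set) → (∀ x → P x → P (π x)) → (∀ x → P x → π x ≡ π′ x)
            → ∀ x y → P x → Orbit π x y → Orbit π′ x y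
Orbit-agree π π′ P closed agree x y px (k , eq) = k , trans (sym (iter-agree π π′ P closed agree k x px)) eq

Orbit-invariant : ∀ {A B : Set} (π : A → A) (l : A → B) (P : A → Set) → (∀ x → P x → P (π x))
                → (∀ x → P x → l (π x) ≡ l x) → ∀ x y → P x → Orbit π x y → l y ≡ l x
Orbit-invariant π l P closed invariant x y px (k , refl) = go k
  where
  go : ∀ k → l (iter π k x) ≡ l x
  go zero    = refl
  go (suc k) = trans (invariant _ (iter-preserves π P closed k x px)) (go k)

true≢false : true ≢ false
true≢false ()

<ᵇ≡true⇒< : ∀ {m n} → (m <ᵇ n) ≡ true → m < n
<ᵇ≡true⇒< {m} {n} h = <ᵇ⇒< m n (Equivalence.from T-≡ h)

<⇒<ᵇ≡true : ∀ {m n} → m < n → (m <ᵇ n) ≡ true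
<⇒<ᵇ≡true lt = Equivalence.to T-≡ (<⇒<ᵇ lt)

∧-intro : ∀ {a b : Bool} → a ≡ true → b ≡ true → a ∧ b ≡ true
∧-intro refl refl = refl

not-true⇒false : ∀ {b} → not b ≡ true → b ≡ false
not-true⇒false {false} _ = refl

indicator : Bool → ℕ
indicator b = if b then 1 else 0

indicator-mono : ∀ {a b : Bool} → (a ≡ true → b ≡ true) → indicator a ≤ indicator b
indicator-mono {false} h = z≤n
indicator-mono {true}  h rewrite h refl = ≤-refl

indicator-∨-≤ : ∀ {a b c : Bool} → (a ≡ true → b ≡ true ⊎ c ≡ true) → indicator a ≤ indicator b + indicator c
indicator-∨-≤ {false} h = z≤n
indicator-∨-≤ {true} {true} h = s≤s z≤n
indicator-∨-≤ {true} {false} {true} h = s≤s z≤n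
indicator-∨-≤ {true} {false} {false} h with h refl
... | inj₁ ()
... | inj₂ ()

module _ {A : Set} where

  countL-cong : ∀ (p q : A → Bool) → (∀ x → p x ≡ q x) → ∀ xs → countL p xs ≡ countL q xs
  countL-cong p q h []       = refl
  countL-cong p q h (x ∷ xs) = cong₂ _+_ (cong indicator (h x)) (countL-cong p q h xs)

  countL-mono : ∀ (p q : A → Bool) → (∀ x → p x ≡ true → q x ≡ true) → ∀ xs → countL p xs ≤ countL q xs
  countL-mono p q h []       = z≤n
  countL-mono p q h (x ∷ xs) = +-mono-≤ (indicator-mono (h x)) (countL-mono p q h xs)

  countL-none : ∀ (p : A → Bool) → (∀ x → p x ≡ false) → ∀ xs → countL p xs ≡ 0
  countL-none p h []       = refl
  countL-none p h (x ∷ xs) rewrite h x = countL-none p h xs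

  countL-≤-+ : ∀ (p q r : A → Bool) → (∀ x → indicator (p x) ≤ indicator (q x) + indicator (r x))
             → ∀ xs → countL p xs ≤ countL q xs + countL r xs
  countL-≤-+ p q r h []       = z≤n
  countL-≤-+ p q r h (x ∷ xs) = begin
    indicator (p x) + countL p xs
      ≤⟨ +-mono-≤ (h x) (countL-≤-+ p q r h xs) ⟩
    (indicator (q x) + indicator (r x)) + (countL q xs + countL r xs)
      ≡⟨ interchange (indicator (q x)) (indicator (r x)) (countL q xs) (countL r xs) ⟩
    (indicator (q x) + countL q xs) + (indicator (r x) + countL r xs) ∎
    where open ≤-Reasoning

  countL-+ : ∀ (p q r : A → Bool) → (∀ x → indicator (p x) ≡ indicator (q x) + indicator (r x))
           → ∀ xs → countL p xs ≡ countL q xs + countL r xs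
  countL-+ p q r h []       = refl
  countL-+ p q r h (x ∷ xs) = begin
    indicator (p x) + countL p xs
      ≡⟨ cong₂ _+_ (h x) (countL-+ p q r h xs) ⟩
    (indicator (q x) + indicator (r x)) + (countL q xs + countL r xs)
      ≡⟨ interchange (indicator (q x)) (indicator (r x)) (countL q xs) (countL r xs) ⟩
    (indicator (q x) + countL q xs) + (indicator (r x) + countL r xs) ∎
    where open ≡-Reasoning

  countL-++ : ∀ (p : A → Bool) xs ys → countL p (xs ++ ys) ≡ countL p xs + countL p ys
  countL-++ p []       ys = refl
  countL-++ p (x ∷ xs) ys = trans (cong (indicator (p x) +_) (countL-++ p xs ys)) (sym (+-assoc (indicator (p x)) _ _))

  countL-positive⇒any : ∀ (p : A → Bool) xs → 1 ≤ countL p xs → any p xs ≡ true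
  countL-positive⇒any p (x ∷ xs) h with p x
  ... | true  = refl
  ... | false = countL-positive⇒any p xs h

  any⇒countL-positive : ∀ (p : A → Bool) xs → any p xs ≡ true → 1 ≤ countL p xs
  any⇒countL-positive p (x ∷ xs) h with p x
  ... | true  = s≤s z≤n
  ... | false = any⇒countL-positive p xs h

  any-cong : ∀ (p q : A → Bool) → (∀ x → p x ≡ q x) → ∀ xs → any p xs ≡ any q xs
  any-cong p q h []       = refl
  any-cong p q h (x ∷ xs) = cong₂ _∨_ (h x) (any-cong p q h xs)

  any-witness : ∀ (p : A → Bool) xs → any p xs ≡ true → ∃ λ x → p x ≡ true
  any-witness p (x ∷ xs) h with p x in px
  ... | true  = x , px
  ... | false = any-witness p xs h

countL-map : ∀ {A B : Set} (p : B → Bool) (g : A → B) xs → countL p (map g xs) ≡ countL (λ x → p (g x)) xs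
countL-map p g []       = refl
countL-map p g (x ∷ xs) = cong (indicator (p (g x)) +_) (countL-map p g xs)

countL-concatMap : ∀ {A B : Set} (p : B → Bool) (f : A → List B) xs
                 → countL p (concatMap f xs) ≡ sum (map (λ x → countL p (f x)) xs)
countL-concatMap p f []       = refl
countL-concatMap p f (x ∷ xs) = trans (countL-++ p (f x) _) (cong (countL p (f x) +_) (countL-concatMap p f xs))

any-applyUpTo⁻ : ∀ (p : ℕ → Bool) (f : ℕ → ℕ) n → any p (applyUpTo f n) ≡ true → ∃ λ k → k < n × p (f k) ≡ true
any-applyUpTo⁻ p f (suc n) h with p (f zero) in pf0
... | true  = zero , s≤s z≤n , pf0
... | false with any-applyUpTo⁻ p (λ x → f (suc x)) n h
...   | k , k<n , pk = suc k , s≤s k<n , pk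

any-applyUpTo⁺ : ∀ (p : ℕ → Bool) (f : ℕ → ℕ) n k → k < n → p (f k) ≡ true → any p (applyUpTo f n) ≡ true
any-applyUpTo⁺ p f (suc n) zero    k<n h rewrite h = refl
any-applyUpTo⁺ p f (suc n) (suc k) (s≤s k<n) h with p (f zero)
... | true  = refl
... | false = any-applyUpTo⁺ p (λ x → f (suc x)) n k k<n h

euler-split-step : ∀ a b c r → 2 * a + 2 * b ≤ c + 4 * r → 2 * a + 2 * suc b ≤ (c + 2) + 4 * r
euler-split-step a b c r h = subst₂ _≤_ (lhs a b) (rhs c r) (+-monoʳ-≤ 2 h)
  where
  lhs : ∀ a b → 2 + (2 * a + 2 * b) ≡ 2 * a + 2 * suc b
  lhs = solve 2 (λ a b → con 2 :+ (con 2 :* a :+ con 2 :* b) := con 2 :* a :+ con 2 :* (con 1 :+ b)) refl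
  rhs : ∀ c r → 2 + (c + 4 * r) ≡ (c + 2) + 4 * r
  rhs = solve 2 (λ c r → con 2 :+ (c :+ con 4 :* r) := (c :+ con 2) :+ con 4 :* r) refl

euler-merge-step : ∀ a b c r r′ → 2 * a + 2 * suc b ≤ c + 4 * r → r ≤ suc r′ → 2 * a + 2 * b ≤ (c + 2) + 4 * r′
euler-merge-step a b c r r′ h r≤1+r′ = +-cancelˡ-≤ 2 _ _ (subst₂ _≤_ (lhs a b) (rhs c r′)
  (≤-trans h (+-monoʳ-≤ c (*-monoʳ-≤ 4 r≤1+r′))))
  where
  lhs : ∀ a b → 2 * a + 2 * suc b ≡ 2 + (2 * a + 2 * b)
  lhs = solve 2 (λ a b → con 2 :* a :+ con 2 :* (con 1 :+ b) := con 2 :+ (con 2 :* a :+ con 2 :* b)) refl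
  rhs : ∀ c r → c + 4 * suc r ≡ 2 + ((c + 2) + 4 * r)
  rhs = solve 2 (λ c r → c :+ con 4 :* (con 1 :+ r) := con 2 :+ ((c :+ con 2) :+ con 4 :* r)) refl

euler-contradiction : ∀ {n z F D} → n ≤ z → 2 * (2 + z) + 2 * F ≤ D + 4 → 2 * (n + F) ≢ 4 + D
euler-contradiction {n} {z} {F} {D} n≤z bound euler = <-irrefl refl (begin-strict
  D + 4                 <⟨ m<m+n (D + 4) {4} z<s ⟩
  D + 4 + 4             ≡⟨ shuffle D ⟩
  4 + (4 + D)           ≡⟨ cong (4 +_) (sym euler) ⟩
  4 + 2 * (n + F)       ≡⟨ regroup n F ⟩
  2 * (2 + n) + 2 * F   ≤⟨ +-monoˡ-≤ (2 * F) (*-monoʳ-≤ 2 (+-monoʳ-≤ 2 n≤z)) ⟩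
  2 * (2 + z) + 2 * F   ≤⟨ bound ⟩
  D + 4                 ∎)
  where
  open ≤-Reasoning
  shuffle : ∀ D → D + 4 + 4 ≡ 4 + (4 + D)
  shuffle = solve 1 (λ D → D :+ con 4 :+ con 4 := con 4 :+ (con 4 :+ D)) refl
  regroup : ∀ n F → 4 + 2 * (n + F) ≡ 2 * (2 + n) + 2 * F
  regroup = solve 2 (λ n F → con 4 :+ con 2 :* (n :+ F) := con 2 :* (con 2 :+ n) :+ con 2 :* F) refl

least-search : (P : ℕ → Bool) → ∀ n
  → (Σ ℕ λ m → P m ≡ true × (∀ j → j < m → P j ≡ false)) ⊎ (∀ j → j < n → P j ≡ false)
least-search P zero = inj₂ (λ j ())
least-search P (suc n) with least-search P n
... | inj₁ found = inj₁ found
... | inj₂ none with P n in Pn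
...   | true  = inj₁ (n , Pn , none)
...   | false = inj₂ λ j j<1+n → below-or-at (m≤n⇒m<n∨m≡n (≤-pred j<1+n))
  where
  below-or-at : ∀ {j} → j < n ⊎ j ≡ n → P j ≡ false
  below-or-at (inj₁ j<n)  = none _ j<n
  below-or-at (inj₂ refl) = Pn

least : (P : ℕ → Bool) → ∀ n → P n ≡ true → Σ ℕ λ m → P m ≡ true × (∀ j → j < m → P j ≡ false)
least P n Pn with least-search P (suc n)
... | inj₁ found = found
... | inj₂ none with trans (sym Pn) (none n ≤-refl)
...   | ()

-- A finite set is presented as in Defs: a domain predicate, an enumeration listing every element
-- once, and an injective code bounded on the domain (which bounds all periods).
module PermutationOrbits
  {A : Set} (_==_ : A → A → Bool)
  (==-sound : ∀ x y → x == y ≡ true → x ≡ y) (==-refl : ∀ x → x == x ≡ true)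
  (inDom : A → Bool) (L : List A) (L-once : ∀ x → countL (_== x) L ≡ 1)
  (code : A → ℕ) (code-injective : ∀ x y → code x ≡ code y → x ≡ y)
  (B : ℕ) (code<B : ∀ x → inDom x ≡ true → code x < B) where

  Dom : A → Set
  Dom x = inDom x ≡ true

  ==-complete : ∀ {x y} → x ≡ y → x == y ≡ true
  ==-complete {x} refl = ==-refl x

  ==-false : ∀ x y → x ≢ y → x == y ≡ false
  ==-false x y x≢y with x == y in eq
  ... | true  = ⊥-elim (x≢y (==-sound x y eq))
  ... | false = refl

  any-L⁺ : ∀ (p : A → Bool) x → p x ≡ true → any p L ≡ true
  any-L⁺ p x px = countL-positive⇒any p L (begin
    1                ≡⟨ sym (L-once x) ⟩
    countL (_== x) L ≤⟨ countL-mono (_== x) p (λ y y=x → subst (λ t → p t ≡ true) (sym (==-sound y x y=x)) px) L ⟩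
    countL p L       ∎)
    where open ≤-Reasoning

  any-L⁻ : ∀ (p : A → Bool) → any p L ≡ false → ∀ x → p x ≡ false
  any-L⁻ p none x with p x in px
  ... | true  = ⊥-elim (true≢false (trans (sym (any-L⁺ p x px)) none))
  ... | false = refl

  countL-≤1 : ∀ (p : A → Bool) → (∀ x y → p x ≡ true → p y ≡ true → x ≡ y) → countL p L ≤ 1
  countL-≤1 p unique with any p L in some
  ... | false = ≤-trans (≤-reflexive (countL-none p (any-L⁻ p some) L)) z≤n
  ... | true with any-witness p L some
  ...   | x , px = begin
    countL p L       ≤⟨ countL-mono p (_== x) (λ y py → ==-complete (unique y x py px)) L ⟩
    countL (_== x) L ≡⟨ L-once x ⟩
    1                ∎
    where open ≤-Reasoning

  code-minimal : (p : A → Bool) → ∀ x → p x ≡ true → Σ A λ m → p m ≡ true × (∀ y → p y ≡ true → code m ≤ code y)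
  code-minimal p x px = descend (suc (code x)) x ≤-refl px
    where
    descend : ∀ fuel x → code x < fuel → p x ≡ true → Σ A λ m → p m ≡ true × (∀ y → p y ≡ true → code m ≤ code y)
    descend (suc fuel) x x<fuel px with any (λ y → p y ∧ (code y <ᵇ code x)) L in smaller
    ... | true with any-witness _ L smaller
    ...   | y , py∧y<x =
      descend fuel y (≤-trans (<ᵇ≡true⇒< (∧-conicalʳ _ _ py∧y<x)) (≤-pred x<fuel)) (∧-conicalˡ _ _ py∧y<x)
    descend (suc fuel) x x<fuel px | false = x , px , λ y py → ≮⇒≥ λ y<x →
      true≢false (trans (sym (∧-intro py (<⇒<ᵇ≡true y<x))) (any-L⁻ _ smaller y))

  record Perm : Set where
    field
      fun       : A → A
      closed    : ∀ x → Dom x → Dom (fun x)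
      injective : ∀ x y → Dom x → Dom y → fun x ≡ fun y → x ≡ y

  orbit? : (A → A) → A → A → Bool
  orbit? π x y = any (λ k → iter π k x == y) (upTo B)

  isOrbitRep : (A → A) → A → Bool
  isOrbitRep π x = inDom x ∧ not (any (λ y → orbit? π x y ∧ (code y <ᵇ code x)) L)

  numOrbits : (A → A) → ℕ
  numOrbits π = countL (isOrbitRep π) L

  module OrbitsOf (P : Perm) where
    open Perm P renaming (fun to π)

    iter-closed : ∀ k x → Dom x → Dom (iter π k x)
    iter-closed = iter-preserves π Dom closed

    iter-injective : ∀ k x y → Dom x → Dom y → iter π k x ≡ iter π k y → x ≡ y
    iter-injective zero    x y dx dy eq = eq
    iter-injective (suc k) x y dx dy eq =
      iter-injective k x y dx dy (injective _ _ (iter-closed k x dx) (iter-closed k y dy) eq)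

    period : ∀ x → Dom x → Σ ℕ λ m → 0 < m × m ≤ B × iter π m x ≡ x
    period x dx with Finₚ.pigeonhole (n<1+n B) codeOfIter
      where
      codeOfIter : Fin (suc B) → Fin B
      codeOfIter i = fromℕ< (code<B (iter π (toℕ i) x) (iter-closed (toℕ i) x dx))
    ... | i , j , i<j , same-code =
      toℕ j ∸ toℕ i , m<n⇒0<n∸m i<j , ≤-trans (m∸n≤m (toℕ j) (toℕ i)) (≤-pred (Finₚ.toℕ<n j)) ,
      iter-injective (toℕ i) _ _ (iter-closed (toℕ j ∸ toℕ i) x dx) dx (begin
        iter π (toℕ i) (iter π (toℕ j ∸ toℕ i) x) ≡⟨ sym (iter-+ π (toℕ i) _ x) ⟩
        iter π (toℕ i + (toℕ j ∸ toℕ i)) x        ≡⟨ cong (λ t → iter π t x) (m+[n∸m]≡n (<⇒≤ i<j)) ⟩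
        iter π (toℕ j) x                          ≡⟨ code-injective _ _ (begin
          code (iter π (toℕ j) x)                    ≡⟨ sym (Finₚ.toℕ-fromℕ< _) ⟩
          toℕ (fromℕ< _)                             ≡⟨ cong toℕ (sym same-code) ⟩
          toℕ (fromℕ< _)                             ≡⟨ Finₚ.toℕ-fromℕ< _ ⟩
          code (iter π (toℕ i) x)                    ∎) ⟩
        iter π (toℕ i) x                          ∎)
      where open ≡-Reasoning

    Orbit-closed : ∀ x y → Dom x → Orbit π x y → Dom y
    Orbit-closed x y dx (k , refl) = iter-closed k x dx

    Orbit-sym : ∀ x y → Dom x → Orbit π x y → Orbit π y x
    Orbit-sym x y dx (k , refl) with period x dx
    ... | suc m , _ , _ , fixed = k * m , (begin
      iter π (k * m) (iter π k x) ≡⟨ sym (iter-+ π (k * m) k x) ⟩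
      iter π (k * m + k) x        ≡⟨ cong (λ t → iter π t x) (trans (+-comm (k * m) k) (sym (*-suc k m))) ⟩
      iter π (k * suc m) x        ≡⟨ iter-*-fixed π (suc m) x fixed k ⟩
      x                           ∎)
      where open ≡-Reasoning

    Orbit-bounded : ∀ x y → Dom x → Orbit π x y → ∃ λ k → k < B × iter π k x ≡ y
    Orbit-bounded x y dx (k , refl) with period x dx
    ... | m@(suc _) , _ , m≤B , fixed = k % m , ≤-trans (m%n<n k m) m≤B , sym (iter-%-fixed π m x fixed k)

    orbit?-complete : ∀ x y → Dom x → Orbit π x y → orbit? π x y ≡ true
    orbit?-complete x y dx o with Orbit-bounded x y dx o
    ... | k , k<B , refl = any-applyUpTo⁺ (λ k → iter π k x == y) (λ t → t) B k k<B (==-refl y)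

    orbit?-sound : ∀ x y → orbit? π x y ≡ true → Orbit π x y
    orbit?-sound x y h with any-applyUpTo⁻ _ (λ t → t) B h
    ... | k , _ , eq = k , ==-sound _ _ eq

    isOrbitRep⁻ : ∀ x → isOrbitRep π x ≡ true → Dom x × (∀ y → Orbit π x y → ¬ code y < code x)
    isOrbitRep⁻ x rep = dx , λ y o y<x → true≢false (trans (sym (∧-intro (orbit?-complete x y dx o) (<⇒<ᵇ≡true y<x)))
                                                          (any-L⁻ _ (not-true⇒false (∧-conicalʳ _ _ rep)) y))
      where dx = ∧-conicalˡ _ _ rep

    isOrbitRep⁺ : ∀ x → Dom x → (∀ y → Orbit π x y → ¬ code y < code x) → isOrbitRep π x ≡ true
    isOrbitRep⁺ x dx least with any (λ y → orbit? π x y ∧ (code y <ᵇ code x)) L in smaller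
    ... | false rewrite dx = refl
    ... | true with any-witness _ L smaller
    ...   | y , o∧y<x = ⊥-elim (least y (orbit?-sound x y (∧-conicalˡ _ _ o∧y<x)) (<ᵇ≡true⇒< (∧-conicalʳ _ _ o∧y<x)))

    ¬isOrbitRep⇒smaller : ∀ x → Dom x → isOrbitRep π x ≡ false → ∃ λ y → Orbit π x y × code y < code x
    ¬isOrbitRep⇒smaller x dx ¬rep with any (λ y → orbit? π x y ∧ (code y <ᵇ code x)) L in smaller
    ... | false rewrite dx = ⊥-elim (true≢false ¬rep)
    ... | true with any-witness _ L smaller
    ...   | y , o∧y<x = y , orbit?-sound x y (∧-conicalˡ _ _ o∧y<x) , <ᵇ≡true⇒< (∧-conicalʳ _ _ o∧y<x)

    orbitRep-unique : ∀ x y → isOrbitRep π x ≡ true → isOrbitRep π y ≡ true → Orbit π x y → x ≡ y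
    orbitRep-unique x y rx ry o with isOrbitRep⁻ x rx | isOrbitRep⁻ y ry
    ... | dx , x-least | dy , y-least =
      code-injective x y (≤-antisym (≮⇒≥ (x-least y o)) (≮⇒≥ (y-least x (Orbit-sym x y dx o))))

    orbitRep : ∀ x → Dom x → Σ A λ m → Orbit π x m × isOrbitRep π m ≡ true × (∀ y → Orbit π x y → code m ≤ code y)
    orbitRep x dx with code-minimal (orbit? π x) x (orbit?-complete x x dx (Orbit-refl π x))
    ... | m , xm , m-least = m , Orbit-x-m ,
        isOrbitRep⁺ m (Orbit-closed x m dx Orbit-x-m)
          (λ y o y<m → <⇒≱ y<m (m-least y (orbit?-complete x y dx (Orbit-trans π Orbit-x-m o)))) ,
        λ y o → m-least y (orbit?-complete x y dx o)
      where Orbit-x-m = orbit?-sound x m xm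

  numOrbits-cong : ∀ π π′ → (∀ x → Dom x → Dom (π x)) → (∀ x → Dom x → π x ≡ π′ x) → numOrbits π ≡ numOrbits π′
  numOrbits-cong π π′ closed agree = countL-cong (isOrbitRep π) (isOrbitRep π′) same-rep L
    where
    same-rep : ∀ x → isOrbitRep π x ≡ isOrbitRep π′ x
    same-rep x with inDom x in dx
    ... | false = refl
    ... | true  = cong not (any-cong _ _ (λ y → cong (λ b → b ∧ (code y <ᵇ code x))
                    (any-cong _ _ (λ k → cong (_== y) (iter-agree π π′ Dom closed agree k x dx)) (upTo B))) L)

  numOrbits-suc : ∀ π ρ m → (∀ y → isOrbitRep π y ≡ true → isOrbitRep ρ y ≡ true)
    → isOrbitRep ρ m ≡ true → isOrbitRep π m ≡ false
    → (∀ y → isOrbitRep ρ y ≡ true → isOrbitRep π y ≡ false → y ≡ m)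
    → numOrbits ρ ≡ suc (numOrbits π)
  numOrbits-suc π ρ m old-rep ρ-rep-m ¬π-rep-m only-m =
    trans (countL-+ _ _ (_== m) pointwise L) (trans (cong (numOrbits π +_) (L-once m)) (+-comm _ 1))
    where
    pointwise : ∀ y → indicator (isOrbitRep ρ y) ≡ indicator (isOrbitRep π y) + indicator (y == m)
    pointwise y with y == m in y=m
    ... | true rewrite ==-sound y m y=m | ρ-rep-m | ¬π-rep-m = refl
    ... | false with isOrbitRep π y in π-rep
    ...   | true rewrite old-rep y π-rep = refl
    ...   | false with isOrbitRep ρ y in ρ-rep
    ...     | false = refl
    ...     | true  = ⊥-elim (true≢false (trans (sym (==-complete (only-m y ρ-rep π-rep))) y=m))

  swap : A → A → A → A
  swap a b x = if x == a then b else (if x == b then a else x)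

  data SwapCase (a b x : A) : Set where
    at-a  : x ≡ a → swap a b x ≡ b → SwapCase a b x
    at-b  : x ≡ b → x ≢ a → swap a b x ≡ a → SwapCase a b x
    other : x ≢ a → x ≢ b → swap a b x ≡ x → SwapCase a b x

  swapCase : ∀ a b x → SwapCase a b x
  swapCase a b x with x == a in x=a
  ... | true  = at-a (==-sound x a x=a) (swap-if x=a)
    where
    swap-if : x == a ≡ true → swap a b x ≡ b
    swap-if x=a rewrite x=a = refl
  ... | false with x == b in x=b
  ...   | true  = at-b (==-sound x b x=b) (λ eq → true≢false (trans (sym (==-complete eq)) x=a)) (swap-if x=a x=b)
    where
    swap-if : x == a ≡ false → x == b ≡ true → swap a b x ≡ a
    swap-if x≠a x=b rewrite x≠a | x=b = refl
  ...   | false = other (λ eq → true≢false (trans (sym (==-complete eq)) x=a))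
                        (λ eq → true≢false (trans (sym (==-complete eq)) x=b)) (swap-if x=a x=b)
    where
    swap-if : x == a ≡ false → x == b ≡ false → swap a b x ≡ x
    swap-if x≠a x≠b rewrite x≠a | x≠b = refl

  swap-a : ∀ a b → swap a b a ≡ b
  swap-a a b with swapCase a b a
  ... | at-a _ eq     = eq
  ... | at-b _ a≢a _  = ⊥-elim (a≢a refl)
  ... | other a≢a _ _ = ⊥-elim (a≢a refl)

  swap-b : ∀ a b → a ≢ b → swap a b b ≡ a
  swap-b a b a≢b with swapCase a b b
  ... | at-a b≡a _    = ⊥-elim (a≢b (sym b≡a))
  ... | at-b _ _ eq   = eq
  ... | other _ b≢b _ = ⊥-elim (b≢b refl)

  swap-other : ∀ a b x → x ≢ a → x ≢ b → swap a b x ≡ x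
  swap-other a b x x≢a x≢b with swapCase a b x
  ... | at-a x≡a _   = ⊥-elim (x≢a x≡a)
  ... | at-b x≡b _ _ = ⊥-elim (x≢b x≡b)
  ... | other _ _ eq = eq

  swap-involutive : ∀ a b → a ≢ b → ∀ x → swap a b (swap a b x) ≡ x
  swap-involutive a b a≢b x with swapCase a b x
  ... | at-a refl eq   rewrite eq = swap-b x b a≢b
  ... | at-b refl _ eq rewrite eq = swap-a a x
  ... | other _ _ eq   rewrite eq = eq

  swap-closed : ∀ a b → Dom a → Dom b → ∀ x → Dom x → Dom (swap a b x)
  swap-closed a b da db x dx with swapCase a b x
  ... | at-a _ eq   rewrite eq = db
  ... | at-b _ _ eq rewrite eq = da
  ... | other _ _ eq rewrite eq = dx

  swap-natural : (f : A → A) → (∀ x y → f x ≡ f y → x ≡ y) → ∀ a b → a ≢ b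
               → ∀ x → swap (f a) (f b) (f x) ≡ f (swap a b x)
  swap-natural f f-injective a b a≢b x with swapCase a b x
  ... | at-a refl eq      rewrite eq = swap-a (f x) (f b)
  ... | at-b refl _ eq    rewrite eq = swap-b (f a) (f x) (λ e → a≢b (f-injective a x e))
  ... | other x≢a x≢b eq  rewrite eq = swap-other (f a) (f b) (f x) (λ e → x≢a (f-injective _ _ e))
                                                                    (λ e → x≢b (f-injective _ _ e))

  swap-invariant : ∀ {B : Set} (g : A → B) a b → g a ≡ g b → ∀ x → g (swap a b x) ≡ g x
  swap-invariant g a b same x with swapCase a b x
  ... | at-a refl eq   rewrite eq = sym same
  ... | at-b refl _ eq rewrite eq = same
  ... | other _ _ eq   rewrite eq = refl

  swapPerm : (P : Perm) → ∀ a b → Dom a → Dom b → a ≢ b → Perm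
  swapPerm P a b da db a≢b = record
    { fun       = λ x → Perm.fun P (swap a b x)
    ; closed    = λ x dx → Perm.closed P _ (swap-closed a b da db x dx)
    ; injective = λ x y dx dy eq → begin
        x                       ≡⟨ sym (swap-involutive a b a≢b x) ⟩
        swap a b (swap a b x)   ≡⟨ cong (swap a b) (Perm.injective P _ _ (swap-closed a b da db x dx)
                                                                         (swap-closed a b da db y dy) eq) ⟩
        swap a b (swap a b y)   ≡⟨ swap-involutive a b a≢b y ⟩
        y                       ∎
    }
    where open ≡-Reasoning

  data AfterSwap (ρ : A → A) (u v y e : A) : Set where
    together : Orbit ρ y e → AfterSwap ρ u v y e
    u-to-v   : Orbit ρ y u → Orbit ρ e v → AfterSwap ρ u v y e
    v-to-u   : Orbit ρ y v → Orbit ρ e u → AfterSwap ρ u v y e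

  AfterSwap-flip : ∀ {ρ u v y e} → AfterSwap ρ u v y e → AfterSwap ρ v u y e
  AfterSwap-flip (together o) = together o
  AfterSwap-flip (u-to-v o p) = v-to-u o p
  AfterSwap-flip (v-to-u o p) = u-to-v o p

  module Swapping (P : Perm) (a b : A) (da : Dom a) (db : Dom b) (a≢b : a ≢ b) where
    π = Perm.fun P
    R = swapPerm P a b da db a≢b
    ρ = Perm.fun R
    module Oπ = OrbitsOf P
    module Oρ = OrbitsOf R

    ρ-a : ρ a ≡ π b
    ρ-a = cong π (swap-a a b)

    ρ-b : ρ b ≡ π a
    ρ-b = cong π (swap-b a b a≢b)

    ρ-other : ∀ w → w ≢ a → w ≢ b → ρ w ≡ π w
    ρ-other w w≢a w≢b = cong π (swap-other a b w w≢a w≢b)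

    ρ-step-in-π-orbit : Orbit π a b → ∀ x → Dom x → Orbit π x (ρ x)
    ρ-step-in-π-orbit ab x dx with swapCase a b x
    ... | at-a refl eq   rewrite eq = Orbit-trans π ab (Orbit-step π b)
    ... | at-b refl _ eq rewrite eq = Orbit-trans π (Oπ.Orbit-sym a x da ab) (Orbit-step π a)
    ... | other _ _ eq   rewrite eq = Orbit-step π x

    Orbit-⊆ : Orbit π a b → ∀ x y → Dom x → Orbit ρ x y → Orbit π x y
    Orbit-⊆ ab x y dx (k , refl) = go k
      where
      go : ∀ k → Orbit π x (iter ρ k x)
      go zero    = Orbit-refl π x
      go (suc k) = Orbit-trans π (go k) (ρ-step-in-π-orbit ab _ (Oρ.iter-closed k x dx))

    afterSwap : ∀ x y → Dom x → Orbit π x y → AfterSwap ρ a b x y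
    afterSwap x y dx (k , refl) = conclude (Oπ.iter-closed k x dx) (go k)
      where
      Touches : A → Set
      Touches w = Orbit ρ w a ⊎ Orbit ρ w b
      Invariant : A → Set
      Invariant w = Orbit ρ x w ⊎ (Touches x × Touches w)
      go : ∀ k → Invariant (iter π k x)
      go zero = inj₁ (Orbit-refl ρ x)
      go (suc k) with go k | swapCase a b (iter π k x)
      ... | inv | at-a w≡a _ = inj₂ (touches-x inv , inj₂ (Oρ.Orbit-sym _ _ db (1 , trans ρ-b (cong π (sym w≡a)))))
        where
        touches-x : Invariant (iter π k x) → Touches x
        touches-x (inj₁ o)       = inj₁ (subst (Orbit ρ x) w≡a o)
        touches-x (inj₂ (t , _)) = t
      ... | inv | at-b w≡b _ _ = inj₂ (touches-x inv , inj₁ (Oρ.Orbit-sym _ _ da (1 , trans ρ-a (cong π (sym w≡b)))))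
        where
        touches-x : Invariant (iter π k x) → Touches x
        touches-x (inj₁ o)       = inj₂ (subst (Orbit ρ x) w≡b o)
        touches-x (inj₂ (t , _)) = t
      ... | inv | other w≢a w≢b _ = extend inv
        where
        forth : Orbit ρ (iter π k x) (iter π (suc k) x)
        forth = 1 , ρ-other _ w≢a w≢b
        back : Orbit ρ (iter π (suc k) x) (iter π k x)
        back = Oρ.Orbit-sym _ _ (Oπ.iter-closed k x dx) forth
        extend : Invariant (iter π k x) → Invariant (iter π (suc k) x)
        extend (inj₁ o)             = inj₁ (Orbit-trans ρ o forth)
        extend (inj₂ (t , inj₁ o))  = inj₂ (t , inj₁ (Orbit-trans ρ back o))
        extend (inj₂ (t , inj₂ o))  = inj₂ (t , inj₂ (Orbit-trans ρ back o))
      conclude : ∀ {w} → Dom w → Invariant w → AfterSwap ρ a b x w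
      conclude dw (inj₁ o)                 = together o
      conclude dw (inj₂ (inj₁ xa , inj₁ wa)) = together (Orbit-trans ρ xa (Oρ.Orbit-sym _ _ dw wa))
      conclude dw (inj₂ (inj₁ xa , inj₂ wb)) = u-to-v xa wb
      conclude dw (inj₂ (inj₂ xb , inj₁ wa)) = v-to-u xb wa
      conclude dw (inj₂ (inj₂ xb , inj₂ wb)) = together (Orbit-trans ρ xb (Oρ.Orbit-sym _ _ dw wb))

    minimalPeriod : Σ ℕ λ p → iter π (suc p) a ≡ a × (∀ i → 0 < i → i < suc p → iter π i a ≢ a)
    minimalPeriod with Oπ.period a da
    ... | suc m , _ , _ , fixed with least (λ j → iter π (suc j) a == a) m (==-complete fixed)
    ...   | j , returns , earlier = j , ==-sound _ _ returns ,
      λ { (suc i) _ (s≤s i<j) back → true≢false (trans (sym (==-complete back)) (earlier i i<j)) }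

    -- From a, ρ runs through the π-cycle from just after b round to a, so it never meets b.
    module SeparatedArc (ab : Orbit π a b) (p : ℕ) (fixed : iter π (suc p) a ≡ a)
                        (minimal : ∀ i → 0 < i → i < suc p → iter π i a ≢ a) where
      m : ℕ
      m = suc p

      k s : ℕ
      k = proj₁ ab % m
      s = m ∸ k

      k<m : k < m
      k<m = m%n<n (proj₁ ab) m

      πᵏa≡b : iter π k a ≡ b
      πᵏa≡b = trans (sym (iter-%-fixed π m a fixed (proj₁ ab))) (proj₂ ab)

      0<k : 0 < k
      0<k = n≢0⇒n>0 λ k≡0 → a≢b (trans (sym (cong (λ t → iter π t a) k≡0)) πᵏa≡b)

      k+s≡m : k + s ≡ m
      k+s≡m = m+[n∸m]≡n (<⇒≤ k<m)

      i<m : ∀ i → i ≤ s → i < m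
      i<m i i≤s = ≤-trans (+-monoˡ-≤ i 0<k) (≤-trans (+-monoʳ-≤ k i≤s) (≤-reflexive k+s≡m))

      cancel-k : ∀ i → iter π (k + i) a ≡ b → iter π i a ≡ a
      cancel-k i eq = Oπ.iter-injective k _ _ (Oπ.iter-closed i a da) da
                        (trans (sym (iter-+ π k i a)) (trans eq (sym πᵏa≡b)))

      OnArc : ℕ → Set
      OnArc j = Σ ℕ λ i → 0 < i × i ≤ s × iter ρ j a ≡ iter π (k + i) a

      on-arc : ∀ j → OnArc j
      on-arc zero = s , m<n⇒0<n∸m k<m , ≤-refl , sym (trans (cong (λ t → iter π t a) k+s≡m) fixed)
      on-arc (suc j) with on-arc j
      ... | i , 0<i , i≤s , eq with m≤n⇒m<n∨m≡n i≤s
      ...   | inj₂ refl = 1 , s≤s z≤n , 0<i , (begin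
        ρ (iter ρ j a)    ≡⟨ cong ρ (trans eq (trans (cong (λ t → iter π t a) k+s≡m) fixed)) ⟩
        ρ a               ≡⟨ ρ-a ⟩
        π b               ≡⟨ cong π (sym πᵏa≡b) ⟩
        iter π (suc k) a  ≡⟨ cong (λ t → iter π t a) (+-comm 1 k) ⟩
        iter π (k + 1) a  ∎)
        where open ≡-Reasoning
      ...   | inj₁ i<s = suc i , s≤s z≤n , i<s , (begin
        ρ (iter ρ j a)         ≡⟨ cong ρ eq ⟩
        ρ (iter π (k + i) a)   ≡⟨ ρ-other _ w≢a w≢b ⟩
        iter π (suc (k + i)) a ≡⟨ cong (λ t → iter π t a) (sym (+-suc k i)) ⟩
        iter π (k + suc i) a   ∎)
        where
        open ≡-Reasoning
        w≢a : iter π (k + i) a ≢ a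
        w≢a = minimal (k + i) (≤-trans 0<k (m≤m+n k i)) (≤-trans (+-monoʳ-< k i<s) (≤-reflexive k+s≡m))
        w≢b : iter π (k + i) a ≢ b
        w≢b eq′ = minimal i 0<i (i<m i (<⇒≤ i<s)) (cancel-k i eq′)

      separated : ¬ Orbit ρ a b
      separated (j , ρʲa≡b) with on-arc j
      ... | i , 0<i , i≤s , eq = minimal i 0<i (i<m i i≤s) (cancel-k i (trans (sym eq) ρʲa≡b))

    swap-separates : Orbit π a b → ¬ Orbit ρ a b
    swap-separates ab = let p , fixed , minimal = minimalPeriod in SeparatedArc.separated ab p fixed minimal

    numOrbits-split-ordered : Orbit π a b → ∀ u v → Dom u → Dom v → Orbit π u v
      → (∀ y e → Dom y → Orbit π y e → AfterSwap ρ u v y e)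
      → ∀ mu mv → Orbit ρ u mu → isOrbitRep ρ mu ≡ true → Orbit ρ v mv → isOrbitRep ρ mv ≡ true
      → (∀ e → Orbit ρ v e → code mv ≤ code e) → code mu < code mv
      → numOrbits ρ ≡ suc (numOrbits π)
    numOrbits-split-ordered ab u v du dv uv after mu mv u-mu mu-rep v-mv mv-rep mv-least mu<mv =
      numOrbits-suc π ρ mv old-rep mv-rep ¬π-rep-mv only-mv
      where
      old-rep : ∀ y → isOrbitRep π y ≡ true → isOrbitRep ρ y ≡ true
      old-rep y rep with Oπ.isOrbitRep⁻ y rep
      ... | dy , least = Oρ.isOrbitRep⁺ y dy λ e o → least e (Orbit-⊆ ab y e dy o)
      ¬π-rep-mv : isOrbitRep π mv ≡ false
      ¬π-rep-mv with isOrbitRep π mv in rep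
      ... | false = refl
      ... | true  = ⊥-elim (proj₂ (Oπ.isOrbitRep⁻ mv rep) mu mv-mu mu<mv)
        where
        mv-mu : Orbit π mv mu
        mv-mu = Orbit-trans π (Oπ.Orbit-sym v mv dv (Orbit-⊆ ab v mv dv v-mv))
                  (Orbit-trans π (Oπ.Orbit-sym u v du uv) (Orbit-⊆ ab u mu du u-mu))
      only-mv : ∀ y → isOrbitRep ρ y ≡ true → isOrbitRep π y ≡ false → y ≡ mv
      only-mv y ρ-rep ¬π-rep with Oρ.isOrbitRep⁻ y ρ-rep
      ... | dy , ρ-least with Oπ.¬isOrbitRep⇒smaller y dy ¬π-rep
      ... | e , y-e , e<y with after y e dy y-e
      ... | together y-e′ = ⊥-elim (ρ-least e y-e′ e<y)
      ... | v-to-u y-v _  = Oρ.orbitRep-unique y mv ρ-rep mv-rep (Orbit-trans ρ y-v v-mv)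
      ... | u-to-v y-u e-v = ⊥-elim (<⇒≱ mu<mv (begin
        code mv ≤⟨ mv-least e (Oρ.Orbit-sym e v (Oπ.Orbit-closed y e dy y-e) e-v) ⟩
        code e  ≤⟨ <⇒≤ e<y ⟩
        code y  ≤⟨ ≤-reflexive (cong code (Oρ.orbitRep-unique y mu ρ-rep mu-rep (Orbit-trans ρ y-u u-mu))) ⟩
        code mu ∎))
        where open ≤-Reasoning

    numOrbits-split : Orbit π a b → numOrbits ρ ≡ suc (numOrbits π)
    numOrbits-split ab with Oρ.orbitRep a da | Oρ.orbitRep b db
    ... | ma , a-ma , ma-rep , ma-least | mb , b-mb , mb-rep , mb-least with <-cmp (code ma) (code mb)
    ... | tri< ma<mb _ _ =
      numOrbits-split-ordered ab a b da db ab afterSwap ma mb a-ma ma-rep b-mb mb-rep mb-least ma<mb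
    ... | tri> _ _ mb<ma =
      numOrbits-split-ordered ab b a db da (Oπ.Orbit-sym a b da ab) (λ y e dy o → AfterSwap-flip (afterSwap y e dy o))
        mb ma b-mb mb-rep a-ma ma-rep ma-least mb<ma
    ... | tri≈ _ ma≡mb _ = ⊥-elim (swap-separates ab (Orbit-trans ρ a-ma
            (subst (λ t → Orbit ρ t b) (sym (code-injective ma mb ma≡mb)) (Oρ.Orbit-sym b mb db b-mb))))

    -- ρ a = π b, and from π b on, ρ follows the π-cycle of b, which avoids a, until it reaches b.
    merge-joins : ¬ Orbit π a b → Orbit ρ a b
    merge-joins ¬ab with Oπ.period b db
    ... | suc m , _ , _ , fixed = Orbit-trans ρ (1 , ρ-a) (reach (go (suc m) (s≤s z≤n)))
      where
      go : ∀ j → 0 < j → Orbit ρ (π b) (iter π j b) ⊎ Orbit ρ (π b) b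
      go (suc zero)    _ = inj₁ (Orbit-refl ρ (π b))
      go (suc (suc j)) _ with go (suc j) (s≤s z≤n)
      ... | inj₂ o = inj₂ o
      ... | inj₁ o with swapCase a b (iter π (suc j) b)
      ...   | at-a w≡a _      = ⊥-elim (¬ab (Oπ.Orbit-sym b a db (suc j , w≡a)))
      ...   | at-b w≡b _ _    = inj₂ (subst (Orbit ρ (π b)) w≡b o)
      ...   | other w≢a w≢b _ = inj₁ (Orbit-trans ρ o (1 , ρ-other _ w≢a w≢b))
      reach : Orbit ρ (π b) (iter π (suc m) b) ⊎ Orbit ρ (π b) b → Orbit ρ (π b) b
      reach (inj₁ o) = subst (Orbit ρ (π b)) fixed o
      reach (inj₂ o) = o

  numOrbits-merge : (P : Perm) → ∀ a b (da : Dom a) (db : Dom b) (a≢b : a ≢ b) → ¬ Orbit (Perm.fun P) a b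
    → numOrbits (Perm.fun P) ≡ suc (numOrbits (Perm.fun (swapPerm P a b da db a≢b)))
  numOrbits-merge P a b da db a≢b ¬ab = begin
    numOrbits (Perm.fun P)
      ≡⟨ numOrbits-cong _ _ (Perm.closed P) (λ x _ → cong (Perm.fun P) (sym (swap-involutive a b a≢b x))) ⟩
    numOrbits (Perm.fun R′)
      ≡⟨ Swapping.numOrbits-split R a b da db a≢b (Swapping.merge-joins P a b da db a≢b ¬ab) ⟩
    suc (numOrbits (Perm.fun R)) ∎
    where
    open ≡-Reasoning
    R  = swapPerm P a b da db a≢b
    R′ = swapPerm R a b da db a≢b

  ConnectedMap : (A → A) → (A → A) → A → Set
  ConnectedMap σ α x₀ = ∀ (l : A → A) → (∀ x → Dom x → l (σ x) ≡ l x) → (∀ x → Dom x → l (α x) ≡ l x)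
                      → ∀ x → Dom x → l x ≡ l x₀

  module EulerInequality (σP : Perm) (α : A → A) (α-closed : ∀ x → Dom x → Dom (α x))
                         (α-involutive : ∀ x → α (α x) ≡ x) (α-no-fixpoint : ∀ x → Dom x → α x ≢ x) where
    σ = Perm.fun σP
    module Oσ = OrbitsOf σP

    occurs : A → List A → Bool
    occurs x Ps = any (_== x) Ps

    covered : List A → A → Bool
    covered Ps x = inDom x ∧ (occurs x Ps ∨ occurs (α x) Ps)

    αOn : List A → A → A
    αOn Ps x = if covered Ps x then α x else x

    covered-α : ∀ Ps x → Dom x → covered Ps (α x) ≡ covered Ps x
    covered-α Ps x dx rewrite α-closed x dx | dx | α-involutive x = ∨-comm (occurs (α x) Ps) (occurs x Ps)

    αOn-closed : ∀ Ps x → Dom x → Dom (αOn Ps x)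
    αOn-closed Ps x dx with covered Ps x
    ... | true  = α-closed x dx
    ... | false = dx

    αOn-involutive : ∀ Ps x → Dom x → αOn Ps (αOn Ps x) ≡ x
    αOn-involutive Ps x dx with covered Ps x in c
    ... | true  rewrite covered-α Ps x dx | c = α-involutive x
    ... | false rewrite c = refl

    partialMap : List A → Perm
    partialMap Ps = record
      { fun       = λ x → σ (αOn Ps x)
      ; closed    = λ x dx → Perm.closed σP _ (αOn-closed Ps x dx)
      ; injective = λ x y dx dy eq → begin
          x                     ≡⟨ sym (αOn-involutive Ps x dx) ⟩
          αOn Ps (αOn Ps x)     ≡⟨ cong (αOn Ps) (Perm.injective σP _ _ (αOn-closed Ps x dx) (αOn-closed Ps y dy) eq) ⟩
          αOn Ps (αOn Ps y)     ≡⟨ αOn-involutive Ps y dy ⟩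
          y                     ∎
      }
      where open ≡-Reasoning

    ρ : List A → A → A
    ρ Ps = Perm.fun (partialMap Ps)

    numRoots : (A → A) → ℕ
    numRoots l = countL (λ x → inDom x ∧ (l x == x)) L

    -- numRoots label stands in for the number of components of the partial map σ ∘ αOn Ps,
    -- so bound is Euler's inequality for it.
    record Labelling (Ps : List A) : Set where
      field
        label   : A → A
        label-σ : ∀ x → Dom x → label (σ x) ≡ label x
        label-α : ∀ x → Dom x → label (αOn Ps x) ≡ label x
        bound   : 2 * numOrbits σ + 2 * numOrbits (ρ Ps) ≤ countL (covered Ps) L + 4 * numRoots label

    label-orbit : ∀ Ps (l : A → A) → (∀ x → Dom x → l (σ x) ≡ l x) → (∀ x → Dom x → l (αOn Ps x) ≡ l x)
                → ∀ x y → Dom x → Orbit (ρ Ps) x y → l y ≡ l x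
    label-orbit Ps l l-σ l-α = Orbit-invariant (ρ Ps) l Dom (Perm.closed (partialMap Ps))
                                 (λ x dx → trans (l-σ _ (αOn-closed Ps x dx)) (l-α x dx))

    σ-repWith : ∀ x b → inDom x ≡ b → A
    σ-repWith x true  dx = proj₁ (Oσ.orbitRep x dx)
    σ-repWith x false _  = x

    σ-rep : A → A
    σ-rep x = σ-repWith x (inDom x) refl

    σ-rep-spec : ∀ x → Dom x → Orbit σ x (σ-rep x) × isOrbitRep σ (σ-rep x) ≡ true
    σ-rep-spec x = spec (inDom x) refl
      where
      spec : ∀ b (e : inDom x ≡ b) → b ≡ true → Orbit σ x (σ-repWith x b e) × isOrbitRep σ (σ-repWith x b e) ≡ true
      spec true e _ = proj₁ (proj₂ (Oσ.orbitRep x e)) , proj₁ (proj₂ (proj₂ (Oσ.orbitRep x e)))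

    σ-rep-σ : ∀ x → Dom x → σ-rep (σ x) ≡ σ-rep x
    σ-rep-σ x dx = Oσ.orbitRep-unique _ _ (proj₂ (σ-rep-spec (σ x) dσx)) (proj₂ (σ-rep-spec x dx))
      (Orbit-trans σ (Oσ.Orbit-sym (σ x) _ dσx (proj₁ (σ-rep-spec (σ x) dσx)))
        (Orbit-trans σ (Oσ.Orbit-sym x (σ x) dx (Orbit-step σ x)) (proj₁ (σ-rep-spec x dx))))
      where dσx = Perm.closed σP x dx

    σ-rep-root : ∀ x → isOrbitRep σ x ≡ true → σ-rep x ≡ x
    σ-rep-root x rep = Oσ.orbitRep-unique _ _ (proj₂ (σ-rep-spec x dx)) rep (Oσ.Orbit-sym _ _ dx (proj₁ (σ-rep-spec x dx)))
      where dx = proj₁ (Oσ.isOrbitRep⁻ x rep)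

    covered-[] : ∀ x → covered [] x ≡ false
    covered-[] x with inDom x
    ... | true  = refl
    ... | false = refl

    αOn-[] : ∀ x → αOn [] x ≡ x
    αOn-[] x rewrite covered-[] x = refl

    no-edges : Labelling []
    no-edges = record
      { label   = σ-rep
      ; label-σ = σ-rep-σ
      ; label-α = λ x _ → cong σ-rep (αOn-[] x)
      ; bound   = begin
          2 * numOrbits σ + 2 * numOrbits (ρ [])      ≡⟨ cong (2 * numOrbits σ +_) (cong (2 *_) ρ-[]) ⟩
          2 * numOrbits σ + 2 * numOrbits σ           ≡⟨ sym (*-distribʳ-+ (numOrbits σ) 2 2) ⟩
          4 * numOrbits σ                             ≤⟨ *-monoʳ-≤ 4 (countL-mono _ _ root L) ⟩
          4 * numRoots σ-rep                          ≡⟨ cong (_+ 4 * numRoots σ-rep) (sym (countL-none _ covered-[] L)) ⟩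
          countL (covered []) L + 4 * numRoots σ-rep  ∎
      }
      where
      open ≤-Reasoning
      ρ-[] : numOrbits (ρ []) ≡ numOrbits σ
      ρ-[] = numOrbits-cong (ρ []) σ (Perm.closed (partialMap [])) (λ x _ → cong σ (αOn-[] x))
      root : ∀ x → isOrbitRep σ x ≡ true → inDom x ∧ (σ-rep x == x) ≡ true
      root x rep = ∧-intro (proj₁ (Oσ.isOrbitRep⁻ x rep)) (==-complete (σ-rep-root x rep))

    module AlreadyCovered (Ps : List A) (IH : Labelling Ps) (d : A)
                          (old : Dom d → occurs d Ps ∨ occurs (α d) Ps ≡ true) where
      open Labelling IH

      covered-same : ∀ y → covered (d ∷ Ps) y ≡ covered Ps y
      covered-same y with inDom y in dy
      ... | false = refl
      ... | true with d == y in d=y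
      ...   | true rewrite ==-sound d y d=y = sym (old dy)
      ...   | false with d == α y in d=αy
      ...     | true rewrite ==-sound d (α y) d=αy =
        trans (∨-zeroʳ _) (sym (trans (∨-comm (occurs y Ps) _)
          (subst (λ t → occurs (α y) Ps ∨ occurs t Ps ≡ true) (α-involutive y) (old (α-closed y dy)))))
      ...     | false = refl

      αOn-same : ∀ y → αOn (d ∷ Ps) y ≡ αOn Ps y
      αOn-same y rewrite covered-same y = refl

      extend : Labelling (d ∷ Ps)
      extend = record
        { label   = label
        ; label-σ = label-σ
        ; label-α = λ x dx → trans (cong label (αOn-same x)) (label-α x dx)
        ; bound   = subst₂ (λ z c → 2 * numOrbits σ + 2 * z ≤ c + 4 * numRoots label)
                      (numOrbits-cong (ρ Ps) (ρ (d ∷ Ps)) (Perm.closed (partialMap Ps)) (λ x _ → cong σ (sym (αOn-same x))))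
                      (countL-cong _ _ (λ y → sym (covered-same y)) L) bound
        }

    module Fresh (Ps : List A) (IH : Labelling Ps) (d : A) (dd : Dom d)
                 (d∉Ps : occurs d Ps ≡ false) (αd∉Ps : occurs (α d) Ps ≡ false) where
      open Labelling IH

      dαd : Dom (α d)
      dαd = α-closed d dd

      d≢αd : d ≢ α d
      d≢αd eq = α-no-fixpoint d dd (sym eq)

      covered-d : covered (d ∷ Ps) d ≡ true
      covered-d rewrite dd | ==-refl d = refl

      uncovered-d : covered Ps d ≡ false
      uncovered-d rewrite dd | d∉Ps | αd∉Ps = refl

      covered-αd : covered (d ∷ Ps) (α d) ≡ true
      covered-αd = trans (covered-α (d ∷ Ps) d dd) covered-d

      uncovered-αd : covered Ps (α d) ≡ false
      uncovered-αd = trans (covered-α Ps d dd) uncovered-d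

      covered-other : ∀ y → y ≢ d → y ≢ α d → covered (d ∷ Ps) y ≡ covered Ps y
      covered-other y y≢d y≢αd
        rewrite ==-false d y (≢-sym y≢d)
              | ==-false d (α y) (λ eq → y≢αd (trans (sym (α-involutive y)) (cong α (sym eq)))) = refl

      αOn-fresh : ∀ x → αOn (d ∷ Ps) x ≡ αOn Ps (swap d (α d) x)
      αOn-fresh x with swapCase d (α d) x
      ... | at-a refl eq   rewrite eq | covered-d | uncovered-αd = refl
      ... | at-b refl _ eq rewrite eq | covered-αd | uncovered-d = α-involutive d
      ... | other x≢d x≢αd eq rewrite eq | covered-other x x≢d x≢αd = refl

      swapped = swapPerm (partialMap Ps) d (α d) dd dαd d≢αd

      numOrbits-fresh : numOrbits (ρ (d ∷ Ps)) ≡ numOrbits (Perm.fun swapped)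
      numOrbits-fresh = numOrbits-cong _ _ (Perm.closed (partialMap (d ∷ Ps))) (λ x _ → cong σ (αOn-fresh x))

      covered-count : countL (covered (d ∷ Ps)) L ≡ countL (covered Ps) L + 2
      covered-count = trans (countL-+ _ _ _ new-pair L)
        (cong (countL (covered Ps) L +_) (trans (countL-+ _ _ _ pair L) (cong₂ _+_ (L-once d) (L-once (α d)))))
        where
        new-pair : ∀ y → indicator (covered (d ∷ Ps) y) ≡ indicator (covered Ps y) + indicator (y == d ∨ y == α d)
        new-pair y with swapCase d (α d) y
        ... | at-a refl _   rewrite covered-d | uncovered-d | ==-refl d = refl
        ... | at-b refl _ _ rewrite covered-αd | uncovered-αd | ==-refl (α d) | ∨-zeroʳ (α d == d) = refl
        ... | other y≢d y≢αd _ rewrite covered-other y y≢d y≢αd | ==-false y d y≢d | ==-false y (α d) y≢αd =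
          sym (+-identityʳ _)
        pair : ∀ y → indicator (y == d ∨ y == α d) ≡ indicator (y == d) + indicator (y == α d)
        pair y with swapCase d (α d) y
        ... | at-a refl _      rewrite ==-refl d | ==-false d (α d) d≢αd = refl
        ... | at-b refl y≢d _  rewrite ==-refl (α d) | ==-false (α d) d y≢d = refl
        ... | other y≢d y≢αd _ rewrite ==-false y d y≢d | ==-false y (α d) y≢αd = refl

      label-α-fresh : ∀ (l : A → A) → (∀ x → Dom x → l (αOn Ps x) ≡ l x) → l d ≡ l (α d)
                    → ∀ x → Dom x → l (αOn (d ∷ Ps) x) ≡ l x
      label-α-fresh l l-α same x dx = begin
        l (αOn (d ∷ Ps) x)            ≡⟨ cong l (αOn-fresh x) ⟩
        l (αOn Ps (swap d (α d) x))   ≡⟨ l-α _ (swap-closed d (α d) dd dαd x dx) ⟩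
        l (swap d (α d) x)            ≡⟨ swap-invariant l d (α d) same x ⟩
        l x                           ∎
        where open ≡-Reasoning

      extend-split : Orbit (ρ Ps) d (α d) → Labelling (d ∷ Ps)
      extend-split d-αd = record
        { label   = label
        ; label-σ = label-σ
        ; label-α = label-α-fresh label label-α (sym (label-orbit Ps label label-σ label-α d (α d) dd d-αd))
        ; bound   = subst₂ (λ z c → 2 * numOrbits σ + 2 * z ≤ c + 4 * numRoots label)
                      (sym (trans numOrbits-fresh (Swapping.numOrbits-split (partialMap Ps) d (α d) dd dαd d≢αd d-αd)))
                      (sym covered-count)
                      (euler-split-step (numOrbits σ) (numOrbits (ρ Ps)) (countL (covered Ps) L) (numRoots label) bound)
        }

      relabel : A → A
      relabel x = if label x == label (α d) then label d else label x

      relabel-cong : ∀ x y → label x ≡ label y → relabel x ≡ relabel y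
      relabel-cong x y eq = cong (λ t → if t == label (α d) then label d else t) eq

      relabel-αd : relabel d ≡ relabel (α d)
      relabel-αd rewrite ==-refl (label (α d)) with label d == label (α d)
      ... | true  = refl
      ... | false = refl

      root-kept : ∀ y → inDom y ∧ (label y == y) ≡ true → (inDom y ∧ (relabel y == y) ≡ true) ⊎ (y == label (α d) ≡ true)
      root-kept y root with label y == label (α d) in same
      ... | true  = inj₂ (subst (λ t → t == label (α d) ≡ true) (==-sound _ _ (∧-conicalʳ _ _ root)) same)
      ... | false = inj₁ root

      numRoots-relabel : numRoots label ≤ suc (numRoots relabel)
      numRoots-relabel = begin
        numRoots label                                 ≤⟨ countL-≤-+ _ _ _ (λ y → indicator-∨-≤ (root-kept y)) L ⟩
        numRoots relabel + countL (_== label (α d)) L  ≡⟨ cong (numRoots relabel +_) (L-once (label (α d))) ⟩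
        numRoots relabel + 1                           ≡⟨ +-comm (numRoots relabel) 1 ⟩
        suc (numRoots relabel)                         ∎
        where open ≤-Reasoning

      extend-merge : ¬ Orbit (ρ Ps) d (α d) → Labelling (d ∷ Ps)
      extend-merge ¬d-αd = record
        { label   = relabel
        ; label-σ = λ x dx → relabel-cong _ _ (label-σ x dx)
        ; label-α = label-α-fresh relabel (λ x dx → relabel-cong _ _ (label-α x dx)) relabel-αd
        ; bound   = subst (λ c → 2 * numOrbits σ + 2 * numOrbits (ρ (d ∷ Ps)) ≤ c + 4 * numRoots relabel)
                      (sym covered-count)
                      (euler-merge-step (numOrbits σ) (numOrbits (ρ (d ∷ Ps))) (countL (covered Ps) L)
                        (numRoots label) (numRoots relabel)
                        (subst (λ z → 2 * numOrbits σ + 2 * z ≤ countL (covered Ps) L + 4 * numRoots label) merged bound)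
                        numRoots-relabel)
        }
        where
        merged : numOrbits (ρ Ps) ≡ suc (numOrbits (ρ (d ∷ Ps)))
        merged = trans (numOrbits-merge (partialMap Ps) d (α d) dd dαd d≢αd ¬d-αd) (cong suc (sym numOrbits-fresh))

    labelling : ∀ Ps → Labelling Ps
    labelling [] = no-edges
    labelling (d ∷ Ps) with inDom d in dd | occurs d Ps in d∈Ps | occurs (α d) Ps in αd∈Ps
    ... | false | _     | _    = AlreadyCovered.extend Ps (labelling Ps) d λ dd′ → ⊥-elim (true≢false (trans (sym dd′) dd))
    ... | true  | true  | _    = AlreadyCovered.extend Ps (labelling Ps) d λ _ → cong (_∨ occurs (α d) Ps) d∈Ps
    ... | true  | false | true = AlreadyCovered.extend Ps (labelling Ps) d λ _ →
                                   trans (cong (_∨ occurs (α d) Ps) d∈Ps) αd∈Ps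
    ... | true  | false | false with orbit? (ρ Ps) d (α d) in d-αd
    ...   | true  = Fresh.extend-split Ps (labelling Ps) d dd d∈Ps αd∈Ps
                      (OrbitsOf.orbit?-sound (partialMap Ps) d (α d) d-αd)
    ...   | false = Fresh.extend-merge Ps (labelling Ps) d dd d∈Ps αd∈Ps
                      (λ o → true≢false (trans (sym (OrbitsOf.orbit?-complete (partialMap Ps) d (α d) dd o)) d-αd))

    covered-L : ∀ x → covered L x ≡ inDom x
    covered-L x with inDom x
    ... | false = refl
    ... | true  rewrite any-L⁺ (_== x) x (==-refl x) = refl

    αOn-L : ∀ x → Dom x → αOn L x ≡ α x
    αOn-L x dx rewrite covered-L x | dx = refl

    euler-inequality : ∀ x₀ → ConnectedMap σ α x₀ → 2 * numOrbits σ + 2 * numOrbits (λ x → σ (α x)) ≤ countL inDom L + 4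
    euler-inequality x₀ connected = begin
      2 * numOrbits σ + 2 * numOrbits (λ x → σ (α x))
        ≡⟨ cong (λ z → 2 * numOrbits σ + 2 * z) (numOrbits-cong _ _ σα-closed (λ x dx → cong σ (sym (αOn-L x dx)))) ⟩
      2 * numOrbits σ + 2 * numOrbits (ρ L)
        ≤⟨ bound ⟩
      countL (covered L) L + 4 * numRoots label
        ≤⟨ +-mono-≤ (≤-reflexive (countL-cong _ _ covered-L L)) (*-monoʳ-≤ 4 one-root) ⟩
      countL inDom L + 4 * 1
        ∎
      where
      open ≤-Reasoning
      open Labelling (labelling L)
      σα-closed : ∀ x → Dom x → Dom (σ (α x))
      σα-closed x dx = Perm.closed σP _ (α-closed x dx)
      constant : ∀ x → Dom x → label x ≡ label x₀
      constant = connected label label-σ (λ x dx → trans (cong label (sym (αOn-L x dx))) (label-α x dx))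
      one-root : numRoots label ≤ 1
      one-root = countL-≤1 _ λ x y rx ry → trans (root x rx) (sym (root y ry))
        where
        root : ∀ x → inDom x ∧ (label x == x) ≡ true → x ≡ label x₀
        root x r = trans (sym (==-sound _ _ (∧-conicalʳ _ _ r))) (constant x (∧-conicalˡ _ _ r))

∣p∪q∣≤∣p∣+∣q∣ : ∀ {n} (p q : Subset n) → ∣ p ∪ q ∣ ≤ ∣ p ∣ + ∣ q ∣
∣p∪q∣≤∣p∣+∣q∣ []          []          = z≤n
∣p∪q∣≤∣p∣+∣q∣ (true ∷ p)  (true ∷ q)  = s≤s (≤-trans (∣p∪q∣≤∣p∣+∣q∣ p q) (+-monoʳ-≤ ∣ p ∣ (n≤1+n ∣ q ∣)))
∣p∪q∣≤∣p∣+∣q∣ (true ∷ p)  (false ∷ q) = s≤s (∣p∪q∣≤∣p∣+∣q∣ p q)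
∣p∪q∣≤∣p∣+∣q∣ (false ∷ p) (true ∷ q)  = ≤-trans (s≤s (∣p∪q∣≤∣p∣+∣q∣ p q)) (≤-reflexive (sym (+-suc ∣ p ∣ ∣ q ∣)))
∣p∪q∣≤∣p∣+∣q∣ (false ∷ p) (false ∷ q) = ∣p∪q∣≤∣p∣+∣q∣ p q

≟-refl : ∀ {n} (a : Fin n) → ⌊ a ≟ a ⌋ ≡ true
≟-refl a with a ≟ a
... | yes _   = refl
... | no a≢a = ⊥-elim (a≢a refl)

≟-sound : ∀ {n} (a b : Fin n) → ⌊ a ≟ b ⌋ ≡ true → a ≡ b
≟-sound a b h with a ≟ b
... | yes a≡b = a≡b

allFin-once : ∀ n (a : Fin n) → countL (λ u → ⌊ u ≟ a ⌋) (allFin n) ≡ 1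
allFin-once (suc n) a = begin
  countL (λ u → ⌊ u ≟ a ⌋) (allFin (suc n))
    ≡⟨ cong (λ us → countL (λ u → ⌊ u ≟ a ⌋) (zero ∷ us)) (sym (Listₚ.map-tabulate (λ i → i) suc)) ⟩
  countL (λ u → ⌊ u ≟ a ⌋) (zero ∷ map suc (allFin n))
    ≡⟨ cong (indicator ⌊ zero ≟ a ⌋ +_) (countL-map _ suc (allFin n)) ⟩
  indicator ⌊ zero ≟ a ⌋ + countL (λ u → ⌊ suc u ≟ a ⌋) (allFin n)
    ≡⟨ at a ⟩
  1 ∎
  where
  open ≡-Reasoning
  at : ∀ a → indicator ⌊ zero ≟ a ⌋ + countL (λ u → ⌊ suc u ≟ a ⌋) (allFin n) ≡ 1
  at zero    = cong suc (countL-none _ (λ _ → refl) (allFin n))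
  at (suc a) = trans (countL-cong _ _ (λ u → suc-≟ u a) (allFin n)) (allFin-once n a)
    where
    suc-≟ : ∀ u a → ⌊ suc u ≟ suc a ⌋ ≡ ⌊ u ≟ a ⌋
    suc-≟ u a with u ≟ a
    ... | yes _ = refl
    ... | no  _ = refl

any-allFin⁺ : ∀ n (p : Fin n → Bool) a → p a ≡ true → any p (allFin n) ≡ true
any-allFin⁺ n p a pa = countL-positive⇒any p (allFin n) (begin
  1                                    ≡⟨ sym (allFin-once n a) ⟩
  countL (λ u → ⌊ u ≟ a ⌋) (allFin n)  ≤⟨ countL-mono _ p (λ u u=a → subst (λ t → p t ≡ true) (sym (≟-sound u a u=a)) pa)
                                                         (allFin n) ⟩
  countL p (allFin n)                  ∎)
  where open ≤-Reasoning

module PlaneMap {n : ℕ} (G : PlaneGraph n) where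
  open PlaneGraph G public
  open Faces adj rot public hiding (latchMult)

  eqD-sound : ∀ d e → eqD d e ≡ true → d ≡ e
  eqD-sound (u , v) (u′ , v′) h with u ≟ u′ | v ≟ v′
  ... | yes refl | yes refl = refl

  eqD-refl : ∀ d → eqD d d ≡ true
  eqD-refl (u , v) rewrite ≟-refl u | ≟-refl v = refl

  darts-once : ∀ d → countL (λ e → eqD e d) darts ≡ 1
  darts-once (a , b) = begin
    countL (λ e → eqD e (a , b)) darts
      ≡⟨ countL-concatMap _ _ (allFin n) ⟩
    sum (map (λ u → countL (λ e → eqD e (a , b)) (map (u ,_) (allFin n))) (allFin n))
      ≡⟨ cong sum (Listₚ.map-cong (λ u → trans (countL-map _ (u ,_) (allFin n)) (row u)) (allFin n)) ⟩
    countL (λ u → ⌊ u ≟ a ⌋) (allFin n)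
      ≡⟨ allFin-once n a ⟩
    1 ∎
    where
    open ≡-Reasoning
    row : ∀ u → countL (λ v → ⌊ u ≟ a ⌋ ∧ ⌊ v ≟ b ⌋) (allFin n) ≡ indicator ⌊ u ≟ a ⌋
    row u with u ≟ a
    ... | yes _ = allFin-once n b
    ... | no  _ = countL-none _ (λ _ → refl) (allFin n)

  code≡combine : ∀ u v → code (u , v) ≡ toℕ (combine u v)
  code≡combine u v = trans (cong (_+ toℕ v) (*-comm (toℕ u) n)) (sym (Finₚ.toℕ-combine u v))

  code-injective : ∀ d e → code d ≡ code e → d ≡ e
  code-injective (u , v) (u′ , v′) eq
    with Finₚ.combine-injective u v u′ v′
           (Finₚ.toℕ-injective (trans (sym (code≡combine u v)) (trans eq (code≡combine u′ v′))))
  ... | refl , refl = refl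

  code<n*n : ∀ d → isDart d ≡ true → code d < n * n
  code<n*n (u , v) _ = subst (_< n * n) (sym (code≡combine u v)) (Finₚ.toℕ<n (combine u v))

  open PermutationOrbits eqD eqD-sound eqD-refl isDart darts darts-once code code-injective (n * n) code<n*n public

  σ : Dart → Dart
  σ (u , v) = (u , rot u v)

  α : Dart → Dart
  α (u , v) = (v , u)

  iter-σ : ∀ k u v → iter σ k (u , v) ≡ (u , iter (rot u) k v)
  iter-σ zero    u v = refl
  iter-σ (suc k) u v = cong σ (iter-σ k u v)

  Orbit-σ : ∀ u v v′ → adj u v ≡ true → adj u v′ ≡ true → Orbit σ (u , v) (u , v′)
  Orbit-σ u v v′ uv uv′ with rot-cyclic u v v′ uv uv′
  ... | k , eq = k , trans (iter-σ k u v) (cong (u ,_) eq)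

  σ-tail : ∀ k d → proj₁ (iter σ k d) ≡ proj₁ d
  σ-tail zero    d = refl
  σ-tail (suc k) d = σ-tail k d

  Orbit-at : (f g : Dart → Dart) (u : Fin n) → (∀ w → proj₁ (f w) ≡ proj₁ w) → (∀ w → proj₁ w ≡ u → f w ≡ g w)
           → ∀ w w′ → proj₁ w ≡ u → Orbit f w w′ → Orbit g w w′
  Orbit-at f g u f-tail agree = Orbit-agree f g (λ w → proj₁ w ≡ u) (λ w tw → trans (f-tail w) tw) agree

  rot-injective : ∀ u v v′ → adj u v ≡ true → adj u v′ ≡ true → rot u v ≡ rot u v′ → v ≡ v′
  rot-injective u v v′ uv uv′ eq
    with rot-cyclic u (rot u v) v (rot-closed u v uv) uv | rot-cyclic u (rot u v) v′ (rot-closed u v uv) uv′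
  ... | j , fʲw≡v | j′ , fʲ′w≡v′ = begin
    v                              ≡⟨ sym fʲw≡v ⟩
    iter f j w                     ≡⟨ cong (iter f j) (sym (trans (cong f fʲ′w≡v′) (sym eq))) ⟩
    iter f j (iter f (suc j′) w)   ≡⟨ sym (iter-+ f j (suc j′) w) ⟩
    iter f (j + suc j′) w          ≡⟨ cong (λ t → iter f t w) (trans (+-comm j (suc j′)) (sym (+-suc j′ j))) ⟩
    iter f (j′ + suc j) w          ≡⟨ iter-+ f j′ (suc j) w ⟩
    iter f j′ (iter f (suc j) w)   ≡⟨ cong (iter f j′ ∘ f) fʲw≡v ⟩
    iter f j′ w                    ≡⟨ fʲ′w≡v′ ⟩
    v′                             ∎
    where
    open ≡-Reasoning
    f = rot u
    w = rot u v

  vertexPerm : Perm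
  vertexPerm = record
    { fun       = σ
    ; closed    = λ (u , v) → rot-closed u v
    ; injective = σ-injective
    }
    where
    σ-injective : ∀ d e → isDart d ≡ true → isDart e ≡ true → σ d ≡ σ e → d ≡ e
    σ-injective (u , v) (u′ , v′) uv u′v′ eq with cong proj₁ eq
    ... | refl = cong (u ,_) (rot-injective u v v′ uv u′v′ (cong proj₂ eq))

  α-closed : ∀ d → isDart d ≡ true → isDart (α d) ≡ true
  α-closed (u , v) uv = trans (adj-sym v u) uv

  α-injective : ∀ d e → α d ≡ α e → d ≡ e
  α-injective d e = cong α

  α-no-fixpoint : ∀ d → isDart d ≡ true → α d ≢ d
  α-no-fixpoint (u , v) uv eq = true≢false (trans (sym uv) (trans (cong (λ t → adj t v) (cong proj₂ eq)) (adj-irrefl v)))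

  facePerm : Perm
  facePerm = record
    { fun       = faceNext
    ; closed    = λ d dd → Perm.closed vertexPerm (α d) (α-closed d dd)
    ; injective = λ d e dd de eq → cong α (Perm.injective vertexPerm (α d) (α e) (α-closed d dd) (α-closed e de) eq)
    }

  module Oφ = OrbitsOf facePerm

  n≤numOrbits-σ : (∀ u → ∃ λ v → adj u v ≡ true) → n ≤ numOrbits σ
  n≤numOrbits-σ neighbour = begin
    n                         ≡⟨ sym (Listₚ.length-tabulate {n = n} (λ i → i)) ⟩
    length (allFin n)         ≤⟨ length≤sum (allFin n) ⟩
    sum (map row (allFin n))  ≡⟨ sym (countL-concatMap (isOrbitRep σ) (λ u → map (u ,_) (allFin n)) (allFin n)) ⟩
    numOrbits σ               ∎
    where
    open ≤-Reasoning
    row : Fin n → ℕ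
    row u = countL (isOrbitRep σ) (map (u ,_) (allFin n))
    rep-in-row : ∀ u v k (m : Dart) → iter σ k (u , v) ≡ m → isOrbitRep σ m ≡ true → 1 ≤ row u
    rep-in-row u v k (u′ , v′) σᵏ≡m rep with trans (sym (σ-tail k (u , v))) (cong proj₁ σᵏ≡m)
    ... | refl = subst (1 ≤_) (sym (countL-map (isOrbitRep σ) (u ,_) (allFin n)))
                   (any⇒countL-positive (λ v → isOrbitRep σ (u , v)) (allFin n)
                     (any-allFin⁺ n (λ v → isOrbitRep σ (u , v)) v′ rep))
    rep-at : ∀ u → 1 ≤ row u
    rep-at u = rep-in-row u v (proj₁ (proj₁ (proj₂ r))) (proj₁ r) (proj₂ (proj₁ (proj₂ r))) (proj₁ (proj₂ (proj₂ r)))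
      where
      v = proj₁ (neighbour u)
      r = OrbitsOf.orbitRep vertexPerm (u , v) (proj₂ (neighbour u))
    length≤sum : ∀ us → length us ≤ sum (map row us)
    length≤sum []       = z≤n
    length≤sum (u ∷ us) = +-mono-≤ (rep-at u) (length≤sum us)

  neighbour : ∀ {x₀ v₀} → adj x₀ v₀ ≡ true → ∀ u → ∃ λ v → adj u v ≡ true
  neighbour {x₀} {v₀} x₀v₀ u = first-step (connected u x₀)
    where
    first-step : ∀ {a} → WalkAvoiding adj ∅ a x₀ → ∃ λ v → adj a v ≡ true
    first-step (stop _)      = v₀ , x₀v₀
    first-step (step _ av _) = _ , av

  -- w₂ may be y: then the second face is one bounded by the edge xy.
  record TwoCommonFaces (x y : Fin n) : Set where
    field
      x≢y             : x ≢ y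
      w₁ w₂ w₃ w₄     : Fin n
      w₁x             : adj w₁ x ≡ true
      w₂x             : adj w₂ x ≡ true
      w₃y             : adj w₃ y ≡ true
      w₄y             : adj w₄ y ≡ true
      different-faces : ¬ Orbit faceNext (w₁ , x) (w₂ , x)
      face₁           : Orbit faceNext (w₁ , x) (w₃ , y)
      face₂           : Orbit faceNext (w₂ , x) (w₄ , y)
      w₁≢y            : w₁ ≢ y
      w₃≢x            : w₃ ≢ x
      w₄≢x            : w₄ ≢ x

  module VertexSplitting {x y : Fin n} (common : TwoCommonFaces x y) where
    open TwoCommonFaces common

    d₁ d₂ d₃ d₄ : Dart
    d₁ = (w₁ , x)
    d₂ = (w₂ , x)
    d₃ = (w₃ , y)
    d₄ = (w₄ , y)

    d₁≢d₂ : d₁ ≢ d₂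
    d₁≢d₂ eq = different-faces (subst (Orbit faceNext d₁) eq (Orbit-refl faceNext d₁))

    d₃≢d₄ : d₃ ≢ d₄
    d₃≢d₄ eq = different-faces
      (Orbit-trans faceNext face₁ (subst (λ t → Orbit faceNext t d₂) (sym eq) (Oφ.Orbit-sym d₂ d₄ w₂x face₂)))

    has-darts : numDarts ≢ 0
    has-darts no-darts = 1≰0 (subst (1 ≤_) no-darts (any⇒countL-positive isDart darts (any-L⁺ isDart d₁ w₁x)))
      where
      1≰0 : ¬ 1 ≤ 0
      1≰0 ()

    dα₁ = α-closed d₁ w₁x
    dα₂ = α-closed d₂ w₂x
    dα₃ = α-closed d₃ w₃y
    dα₄ = α-closed d₄ w₄y
    α₁≢α₂ = d₁≢d₂ ∘ α-injective d₁ d₂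
    α₃≢α₄ = d₃≢d₄ ∘ α-injective d₃ d₄

    -- ρ₂ cuts the rotation at x between the darts towards w₁ and w₂,
    -- and at y between those towards w₃ and w₄.
    R₁ = swapPerm vertexPerm (α d₁) (α d₂) dα₁ dα₂ α₁≢α₂
    ρ₁ = Perm.fun R₁
    R₂ = swapPerm R₁ (α d₃) (α d₄) dα₃ dα₄ α₃≢α₄
    ρ₂ = Perm.fun R₂

    ρ₁-away-from-x : ∀ w → proj₁ w ≢ x → ρ₁ w ≡ σ w
    ρ₁-away-from-x w w≢x = cong σ (swap-other _ _ w (w≢x ∘ cong proj₁) (w≢x ∘ cong proj₁))

    ρ₂-away-from-y : ∀ w → proj₁ w ≢ y → ρ₂ w ≡ ρ₁ w
    ρ₂-away-from-y w w≢y = cong ρ₁ (swap-other _ _ w (w≢y ∘ cong proj₁) (w≢y ∘ cong proj₁))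

    ρ₁-tail : ∀ w → proj₁ (ρ₁ w) ≡ proj₁ w
    ρ₁-tail = swap-invariant proj₁ (α d₁) (α d₂) refl

    ρ₁-at-y : ∀ v v′ → adj y v ≡ true → adj y v′ ≡ true → Orbit ρ₁ (y , v) (y , v′)
    ρ₁-at-y v v′ yv yv′ = Orbit-at σ ρ₁ y (λ _ → refl) (λ w tw → sym (ρ₁-away-from-x w (λ tw′ → x≢y (trans (sym tw′) tw))))
                            (y , v) (y , v′) refl (Orbit-σ y v v′ yv yv′)

    numOrbits-ρ₂ : numOrbits ρ₂ ≡ 2 + numOrbits σ
    numOrbits-ρ₂ = trans (Swapping.numOrbits-split R₁ (α d₃) (α d₄) dα₃ dα₄ α₃≢α₄ (ρ₁-at-y w₃ w₄ dα₃ dα₄))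
                         (cong suc (Swapping.numOrbits-split vertexPerm (α d₁) (α d₂) dα₁ dα₂ α₁≢α₂
                                      (Orbit-σ x w₁ w₂ dα₁ dα₂)))

    Ψ = swapPerm facePerm d₁ d₂ w₁x w₂x d₁≢d₂
    ψ = Perm.fun Ψ

    ψ-joins-d₁-d₂ : Orbit ψ d₁ d₂
    ψ-joins-d₁-d₂ = Swapping.merge-joins facePerm d₁ d₂ w₁x w₂x d₁≢d₂ different-faces

    Orbit-φ⇒ψ : ∀ d e → isDart d ≡ true → Orbit faceNext d e → Orbit ψ d e
    Orbit-φ⇒ψ d e dd o = Swapping.Orbit-⊆ Ψ d₁ d₂ w₁x w₂x d₁≢d₂ ψ-joins-d₁-d₂ d e dd
      (Orbit-agree faceNext _ Dom (Perm.closed facePerm)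
         (λ w _ → cong faceNext (sym (swap-involutive d₁ d₂ d₁≢d₂ w))) d e dd o)

    ψ-joins-d₃-d₄ : Orbit ψ d₃ d₄
    ψ-joins-d₃-d₄ = Orbit-trans ψ (OrbitsOf.Orbit-sym Ψ d₁ d₃ w₁x (Orbit-φ⇒ψ d₁ d₃ w₁x face₁))
                      (Orbit-trans ψ ψ-joins-d₁-d₂ (Orbit-φ⇒ψ d₂ d₄ w₂x face₂))

    Φ₁ : Perm
    Φ₁ = record
      { fun       = λ w → ρ₁ (α w)
      ; closed    = λ w dw → Perm.closed R₁ _ (α-closed w dw)
      ; injective = λ w w′ dw dw′ eq → cong α (Perm.injective R₁ _ _ (α-closed w dw) (α-closed w′ dw′) eq)
      }
    φ₁ = Perm.fun Φ₁

    φ₁≗ψ : ∀ w → φ₁ w ≡ ψ w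
    φ₁≗ψ w = cong σ (swap-natural α α-injective d₁ d₂ d₁≢d₂ w)

    -- Splitting x merges the two common faces into one; splitting y cuts it in two again.
    numOrbits-ρ₂α : numOrbits (λ w → ρ₂ (α w)) ≡ numFaces
    numOrbits-ρ₂α = begin
      numOrbits (λ w → ρ₂ (α w))
        ≡⟨ numOrbits-cong _ _ (λ w dw → Perm.closed R₂ _ (α-closed w dw))
             (λ w _ → cong ρ₁ (swap-natural α α-injective d₃ d₄ d₃≢d₄ w)) ⟩
      numOrbits (Perm.fun (swapPerm Φ₁ d₃ d₄ w₃y w₄y d₃≢d₄))
        ≡⟨ Swapping.numOrbits-split Φ₁ d₃ d₄ w₃y w₄y d₃≢d₄
             (Orbit-agree ψ φ₁ Dom (Perm.closed Ψ) (λ w _ → sym (φ₁≗ψ w)) d₃ d₄ w₃y ψ-joins-d₃-d₄) ⟩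
      suc (numOrbits φ₁)
        ≡⟨ cong suc (numOrbits-cong φ₁ ψ (Perm.closed Φ₁) (λ w _ → φ₁≗ψ w)) ⟩
      suc (numOrbits ψ)
        ≡⟨ sym (numOrbits-merge facePerm d₁ d₂ w₁x w₂x d₁≢d₂ different-faces) ⟩
      numFaces ∎
      where open ≡-Reasoning

    module _ (two-vertices-never-separate : ∀ S → IsSeparator adj S → 3 ≤ ∣ S ∣) where
      S : Subset n
      S = ⁅ x ⁆ ∪ ⁅ y ⁆

      ∣S∣≤2 : ∣ S ∣ ≤ 2
      ∣S∣≤2 = ≤-trans (∣p∪q∣≤∣p∣+∣q∣ ⁅ x ⁆ ⁅ y ⁆) (≤-reflexive (cong₂ _+_ (∣⁅x⁆∣≡1 x) (∣⁅x⁆∣≡1 y)))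

      ∉S : ∀ h → h ≢ x → h ≢ y → h ∉ S
      ∉S h h≢x h≢y h∈S with x∈p∪q⁻ ⁅ x ⁆ ⁅ y ⁆ h∈S
      ... | inj₁ h∈x = h≢x (x∈⁅y⁆⇒x≡y x h∈x)
      ... | inj₂ h∈y = h≢y (x∈⁅y⁆⇒x≡y y h∈y)

      ∉S⇒≢x : ∀ {h} → h ∉ S → h ≢ x
      ∉S⇒≢x h∉S refl = h∉S (x∈p∪q⁺ (inj₁ (x∈⁅x⁆ x)))

      ∉S⇒≢y : ∀ {h} → h ∉ S → h ≢ y
      ∉S⇒≢y h∉S refl = h∉S (x∈p∪q⁺ {p = ⁅ x ⁆} (inj₂ (x∈⁅x⁆ y)))

      adj⇒≢ : ∀ {u v} → adj u v ≡ true → u ≢ v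
      adj⇒≢ {u} uv refl = true≢false (trans (sym uv) (adj-irrefl u))

      w₁∉S : w₁ ∉ S
      w₁∉S = ∉S w₁ (adj⇒≢ w₁x) w₁≢y

      -- Triconnectivity only refutes the absence of a walk, so labels are compared under ¬ ¬ until
      -- decidability of dart equality closes the argument in ρ₂-connected.
      reachable : ∀ h → h ∉ S → ¬ ¬ WalkAvoiding adj S w₁ h
      reachable h h∉S no-walk with ≤-trans (two-vertices-never-separate S (w₁ , h , w₁∉S , h∉S , no-walk)) ∣S∣≤2
      ... | s≤s (s≤s ())

      walk-start : ∀ {a c} → WalkAvoiding adj S a c → a ∉ S
      walk-start (stop a∉S)     = a∉S
      walk-start (step a∉S _ _) = a∉S

      module _ (l : Dart → Dart) (l-ρ₂ : ∀ w → isDart w ≡ true → l (ρ₂ w) ≡ l w)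
               (l-α : ∀ w → isDart w ≡ true → l (α w) ≡ l w) where

        l-orbit : ∀ u v → isDart u ≡ true → Orbit ρ₂ u v → l v ≡ l u
        l-orbit = Orbit-invariant ρ₂ l (λ w → isDart w ≡ true) (Perm.closed R₂) l-ρ₂

        Uniform : Fin n → Set
        Uniform h = ∀ v → adj h v ≡ true → l (h , v) ≡ l d₁

        uniform-at : ∀ h → h ≢ x → h ≢ y → ∀ v v′ → adj h v ≡ true → adj h v′ ≡ true → l (h , v′) ≡ l (h , v)
        uniform-at h h≢x h≢y v v′ hv hv′ = l-orbit (h , v) (h , v′) hv
          (Orbit-at σ ρ₂ h (λ _ → refl) ρ₂-is-σ (h , v) (h , v′) refl (Orbit-σ h v v′ hv hv′))
          where
          ρ₂-is-σ : ∀ w → proj₁ w ≡ h → σ w ≡ ρ₂ w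
          ρ₂-is-σ w refl = sym (trans (ρ₂-away-from-y w h≢y) (ρ₁-away-from-x w h≢x))

        uniform-w₁ : Uniform w₁
        uniform-w₁ v w₁v = uniform-at w₁ (adj⇒≢ w₁x) w₁≢y x v w₁x w₁v

        uniform-walk : ∀ {a c} → WalkAvoiding adj S a c → Uniform a → Uniform c
        uniform-walk (stop _) uniform = uniform
        uniform-walk (step {a} {a′} _ aa′ rest) uniform = uniform-walk rest λ v a′v →
          trans (uniform-at a′ (∉S⇒≢x a′∉S) (∉S⇒≢y a′∉S) a v (trans (adj-sym a′ a) aa′) a′v)
                (trans (l-α (a , a′) aa′) (uniform a′ aa′))
          where a′∉S = walk-start rest

        uniform-off-S : ∀ h → h ∉ S → ¬ ¬ Uniform h
        uniform-off-S h h∉S ¬uniform = reachable h h∉S λ walk → ¬uniform (uniform-walk walk uniform-w₁)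

        from-ends : ∀ {a b w} → isDart a ≡ true → isDart w ≡ true
                  → AfterSwap ρ₂ a b a w → l a ≡ l d₁ → l b ≡ l d₁ → l w ≡ l d₁
        from-ends da dw (together a-w) la lb = trans (l-orbit _ _ da a-w) la
        from-ends da dw (u-to-v _ w-b) la lb = trans (sym (l-orbit _ _ dw w-b)) lb
        from-ends da dw (v-to-u _ w-a) la lb = trans (sym (l-orbit _ _ dw w-a)) la

        uniform-y : ∀ v → adj y v ≡ true → ¬ ¬ (l (y , v) ≡ l d₁)
        uniform-y v yv k =
          uniform-off-S w₃ (∉S w₃ w₃≢x (adj⇒≢ w₃y)) λ uniform₃ →
          uniform-off-S w₄ (∉S w₄ w₄≢x (adj⇒≢ w₄y)) λ uniform₄ →
          k (from-ends dα₃ yv (Swapping.afterSwap R₁ (α d₃) (α d₄) dα₃ dα₄ α₃≢α₄ (α d₃) (y , v) dα₃ (ρ₁-at-y w₃ v dα₃ yv))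
              (trans (l-α d₃ w₃y) (uniform₃ y w₃y)) (trans (l-α d₄ w₄y) (uniform₄ y w₄y)))

        uniform-x : ∀ v → adj x v ≡ true → ¬ ¬ (l (x , v) ≡ l d₁)
        uniform-x v xv k = b₁-uniform (w₂ ≟ y) λ lb₁ →
          k (from-ends dα₁ xv
              (to-ρ₂ (Swapping.afterSwap vertexPerm (α d₁) (α d₂) dα₁ dα₂ α₁≢α₂ (α d₁) (x , v) dα₁ (Orbit-σ x w₁ v dα₁ xv)))
              (l-α d₁ w₁x) lb₁)
          where
          at-x : ∀ u w → proj₁ u ≡ x → Orbit ρ₁ u w → Orbit ρ₂ u w
          at-x = Orbit-at ρ₁ ρ₂ x ρ₁-tail (λ w tw → sym (ρ₂-away-from-y w (λ tw′ → x≢y (trans (sym tw) tw′))))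
          to-ρ₂ : AfterSwap ρ₁ (α d₁) (α d₂) (α d₁) (x , v) → AfterSwap ρ₂ (α d₁) (α d₂) (α d₁) (x , v)
          to-ρ₂ (together o) = together (at-x _ _ refl o)
          to-ρ₂ (u-to-v o p) = u-to-v (at-x _ _ refl o) (at-x _ _ refl p)
          to-ρ₂ (v-to-u o p) = v-to-u (at-x _ _ refl o) (at-x _ _ refl p)
          b₁-uniform : Dec (w₂ ≡ y) → ¬ ¬ (l (α d₂) ≡ l d₁)
          b₁-uniform (yes refl) k′ = uniform-y x w₂x λ eq → k′ (trans (l-α d₂ w₂x) eq)
          b₁-uniform (no w₂≢y)  k′ = uniform-off-S w₂ (∉S w₂ (adj⇒≢ w₂x) w₂≢y) λ uniform₂ →
                                       k′ (trans (l-α d₂ w₂x) (uniform₂ x w₂x))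

      ρ₂-connected : ConnectedMap ρ₂ α d₁
      ρ₂-connected l l-ρ₂ l-α (u , v) uv = decidable-stable (≡-dec _≟_ _≟_ (l (u , v)) (l d₁)) (by-tail (u ≟ x) (u ≟ y))
        where
        by-tail : Dec (u ≡ x) → Dec (u ≡ y) → ¬ ¬ (l (u , v) ≡ l d₁)
        by-tail (yes refl) _          = uniform-x l l-ρ₂ l-α v uv
        by-tail (no _)     (yes refl) = uniform-y l l-ρ₂ l-α v uv
        by-tail (no u≢x)   (no u≢y) k = uniform-off-S l l-ρ₂ l-α u (∉S u u≢x u≢y) λ uniform → k (uniform v uv)

      not-spherical : 2 * (n + numFaces) ≢ 4 + numDarts
      not-spherical = euler-contradiction (n≤numOrbits-σ (neighbour w₁x))
        (subst₂ (λ v f → 2 * v + 2 * f ≤ numDarts + 4) numOrbits-ρ₂ numOrbits-ρ₂α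
           (EulerInequality.euler-inequality R₂ α α-closed (λ _ → refl) α-no-fixpoint d₁ ρ₂-connected))

  two-common-faces-impossible : (∀ S → IsSeparator adj S → 3 ≤ ∣ S ∣) → ∀ {x y} → ¬ TwoCommonFaces x y
  two-common-faces-impossible separators-large common =
    [ VertexSplitting.has-darts common , VertexSplitting.not-spherical common separators-large ]′ spherical

  face-predecessor : ∀ e → isDart e ≡ true → Σ Dart λ p → faceNext p ≡ e × Orbit faceNext e p
  face-predecessor e de with Oφ.period e de
  ... | suc m , _ , _ , fixed = iter faceNext m e , fixed , (m , refl)

  entering-dart : ∀ d u → onFace d u ≡ true → Σ (Fin n) λ w → adj w u ≡ true × Orbit faceNext d (w , u)
  entering-dart d u on with any-witness _ (allFin n) on
  ... | v , uv∧d-uv with face-predecessor (u , v) (∧-conicalˡ _ _ uv∧d-uv)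
  ...   | (w , u′) , next≡uv , uv-wu′ with cong proj₁ next≡uv
  ...     | refl = w , Oφ.Orbit-closed (u , v) (w , u) (∧-conicalˡ _ _ uv∧d-uv) uv-wu′ ,
                   Orbit-trans faceNext (Oφ.orbit?-sound d (u , v) (∧-conicalʳ _ _ uv∧d-uv)) uv-wu′

  record Chord (d : Dart) (x y : Fin n) : Set where
    field
      ends-differ : x ≢ y
      x-on-face   : onFace d x ≡ true
      y-on-face   : onFace d y ≡ true
      xy-off-face : ¬ Orbit faceNext d (x , y)
      yx-off-face : ¬ Orbit faceNext d (y , x)

  Chord-sym : ∀ {d x y} → Chord d x y → Chord d y x
  Chord-sym c = record
    { ends-differ = ≢-sym ends-differ
    ; x-on-face   = y-on-face
    ; y-on-face   = x-on-face
    ; xy-off-face = yx-off-face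
    ; yx-off-face = xy-off-face
    }
    where open Chord c

  isChord⇒Chord : ∀ d x y → isDart d ≡ true → isChord d x y ≡ true → Chord d x y
  isChord⇒Chord d x y dd chord = record
    { ends-differ = λ x≡y → true≢false
                      (trans (sym (≟-refl y)) (subst (λ t → ⌊ t ≟ y ⌋ ≡ false) x≡y (not-true⇒false distinct)))
    ; x-on-face   = ∧-conicalˡ (onFace d x) _ on-face
    ; y-on-face   = ∧-conicalˡ (onFace d y) _ (∧-conicalʳ (onFace d x) _ on-face)
    ; xy-off-face = off-face (∨-conicalˡ (sameFace d (x , y)) (sameFace d (y , x)) not-boundary)
    ; yx-off-face = off-face (∨-conicalʳ (sameFace d (x , y)) (sameFace d (y , x)) not-boundary)
    }
    where
    distinct : not ⌊ x ≟ y ⌋ ≡ true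
    distinct = ∧-conicalˡ (not ⌊ x ≟ y ⌋) _ chord
    on-face : onFace d x ∧ onFace d y ∧ not (boundaryEdge d x y) ≡ true
    on-face = ∧-conicalʳ (not ⌊ x ≟ y ⌋) _ chord
    not-boundary : boundaryEdge d x y ≡ false
    not-boundary = not-true⇒false (∧-conicalʳ (onFace d y) _ (∧-conicalʳ (onFace d x) _ on-face))
    off-face : ∀ {e} → sameFace d e ≡ false → ¬ Orbit faceNext d e
    off-face {e} off o = true≢false (trans (sym (Oφ.orbit?-complete d e dd o)) off)

  record ChordEntry (d : Dart) (x y : Fin n) : Set where
    field
      from     : Fin n
      from-x   : adj from x ≡ true
      on-face  : Orbit faceNext d (from , x)
      from≢y   : from ≢ y

  entering-chord-end : ∀ {d x y} → Chord d x y → ChordEntry d x y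
  entering-chord-end {d} {x} c = record
    { from    = proj₁ entry
    ; from-x  = proj₁ (proj₂ entry)
    ; on-face = proj₂ (proj₂ entry)
    ; from≢y  = λ from≡y → Chord.yx-off-face c (subst (λ t → Orbit faceNext d (t , x)) from≡y (proj₂ (proj₂ entry)))
    }
    where
    entry : Σ (Fin n) λ w → adj w x ≡ true × Orbit faceNext d (w , x)
    entry = entering-dart d x (Chord.x-on-face c)

  module _ {x y : Fin n} where

    chords-in-two-faces : ∀ {d d′} → isDart d ≡ true → isDart d′ ≡ true → Chord d x y → Chord d′ x y
                        → ¬ Orbit faceNext d d′ → TwoCommonFaces x y
    chords-in-two-faces {d} {d′} dd dd′ c c′ different = record
      { x≢y             = Chord.ends-differ c
      ; w₁ = E₁.from ; w₂ = E₂.from ; w₃ = E₃.from ; w₄ = E₄.from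
      ; w₁x = E₁.from-x ; w₂x = E₂.from-x ; w₃y = E₃.from-x ; w₄y = E₄.from-x
      ; different-faces = λ o → different
                            (Orbit-trans faceNext E₁.on-face (Orbit-trans faceNext o (Oφ.Orbit-sym d′ _ dd′ E₂.on-face)))
      ; face₁           = Orbit-trans faceNext (Oφ.Orbit-sym d _ dd E₁.on-face) E₃.on-face
      ; face₂           = Orbit-trans faceNext (Oφ.Orbit-sym d′ _ dd′ E₂.on-face) E₄.on-face
      ; w₁≢y            = E₁.from≢y
      ; w₃≢x            = E₃.from≢y
      ; w₄≢x            = E₄.from≢y
      }
      where
      module E₁ = ChordEntry (entering-chord-end c)
      module E₂ = ChordEntry (entering-chord-end c′)
      module E₃ = ChordEntry (entering-chord-end (Chord-sym c))
      module E₄ = ChordEntry (entering-chord-end (Chord-sym c′))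

    chord-and-edge : ∀ {d} → isDart d ≡ true → Chord d x y → adj x y ≡ true → TwoCommonFaces x y
    chord-and-edge {d} dd c xy = record
      { x≢y             = Chord.ends-differ c
      ; w₁ = E₁.from ; w₂ = y ; w₃ = E₃.from ; w₄ = w₄
      ; w₁x             = E₁.from-x
      ; w₂x             = yx
      ; w₃y             = E₃.from-x
      ; w₄y             = subst (λ t → adj w₄ t ≡ true) p-tail (Oφ.Orbit-closed (y , x) p yx yx-p)
      ; different-faces = λ o → Chord.yx-off-face c (Orbit-trans faceNext E₁.on-face o)
      ; face₁           = Orbit-trans faceNext (Oφ.Orbit-sym d _ dd E₁.on-face) E₃.on-face
      ; face₂           = subst (λ t → Orbit faceNext (y , x) (w₄ , t)) p-tail yx-p
      ; w₁≢y            = E₁.from≢y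
      ; w₃≢x            = E₃.from≢y
      ; w₄≢x            = w₄≢x
      }
      where
      module E₁ = ChordEntry (entering-chord-end c)
      module E₃ = ChordEntry (entering-chord-end (Chord-sym c))
      yx : adj y x ≡ true
      yx = trans (adj-sym y x) xy
      predecessor = face-predecessor (y , x) yx
      p : Dart
      p = proj₁ predecessor
      yx-p : Orbit faceNext (y , x) p
      yx-p = proj₂ (proj₂ predecessor)
      w₄ : Fin n
      w₄ = proj₁ p
      p-tail : proj₂ p ≡ y
      p-tail = cong proj₁ (proj₁ (proj₂ predecessor))
      rot-w₄ : rot y w₄ ≡ x
      rot-w₄ = trans (cong (λ t → rot t w₄) (sym p-tail)) (cong proj₂ (proj₁ (proj₂ predecessor)))
      -- rot y is a single cycle through x and w₃ ≢ x, so it cannot fix x.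
      w₄≢x : w₄ ≢ x
      w₄≢x w₄≡x = E₃.from≢y (trans (sym (proj₂ cycle)) (iter-fixed (rot y) x rot-x (proj₁ cycle)))
        where
        rot-x : rot y x ≡ x
        rot-x = trans (cong (rot y) (sym w₄≡x)) rot-w₄
        cycle = rot-cyclic y x E₃.from yx (trans (adj-sym y E₃.from) E₃.from-x)

  chordFace : Fin n → Fin n → Dart → Bool
  chordFace x y d = isFaceRep d ∧ (4 ≤ᵇ faceSize d) ∧ isChord d x y

  chordFace⇒Chord : ∀ x y d → chordFace x y d ≡ true → isDart d ≡ true × isOrbitRep faceNext d ≡ true × Chord d x y
  chordFace⇒Chord x y d counted =
    dd , rep , isChord⇒Chord d x y dd (∧-conicalʳ (4 ≤ᵇ faceSize d) _ (∧-conicalʳ (isFaceRep d) _ counted))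
    where
    rep : isFaceRep d ≡ true
    rep = ∧-conicalˡ (isFaceRep d) _ counted
    dd : isDart d ≡ true
    dd = ∧-conicalˡ (isDart d) _ rep

  latchMult-≤1 : (∀ {x y} → ¬ TwoCommonFaces x y) → ∀ x y → latchMult G x y ≤ 1
  latchMult-≤1 impossible x y = bound (adj x y) refl
    where
    no-chord : adj x y ≡ true → ∀ d → chordFace x y d ≡ false
    no-chord xy d with chordFace x y d in counted
    ... | false = refl
    ... | true  = let dd , _ , c = chordFace⇒Chord x y d counted in ⊥-elim (impossible (chord-and-edge dd c xy))
    one-face : ∀ d d′ → chordFace x y d ≡ true → chordFace x y d′ ≡ true → d ≡ d′
    one-face d d′ counted counted′ with orbit? faceNext d d′ in same
    ... | true  = Oφ.orbitRep-unique d d′ (proj₁ (proj₂ (chordFace⇒Chord x y d counted)))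
                    (proj₁ (proj₂ (chordFace⇒Chord x y d′ counted′))) (Oφ.orbit?-sound d d′ same)
    ... | false = let dd , _ , c = chordFace⇒Chord x y d counted ; dd′ , _ , c′ = chordFace⇒Chord x y d′ counted′ in
                  ⊥-elim (impossible (chords-in-two-faces dd dd′ c c′
                    (λ o → true≢false (trans (sym (Oφ.orbit?-complete d d′ dd o)) same))))
    bound : ∀ b → adj x y ≡ b → (if b then 1 else 0) + countD (chordFace x y) ≤ 1
    bound true  xy = s≤s (≤-reflexive (countL-none _ (no-chord xy) darts))
    bound false _  = countL-≤1 _ one-face

proposition6 : ∀ {n : ℕ} (G : PlaneGraph n) → Triconnected (PlaneGraph.adj G) → LatchingSimple G
proposition6 G (_ , separators-large) =
  PlaneMap.latchMult-≤1 G (PlaneMap.two-common-faces-impossible G separators-large)
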